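{- Let $n,d,p$ be non-negative integers with $d<n$ and $p\le n-d$. Then: (1) for every $\tau\in\bar{\mathcal{S}}_p(n,d)$, its p-sequence $(p_0,\dots,p_d)$ is a sparse composition of $p$; (2) for every sparse composition $(c_0,\dots,c_d)$ of $p$ and all co-signotopes $\tau_0,\dots,\tau_d$ with $\tau_i\in\bar{\mathcal{S}}_{c_i,i}(n,d)$ for each $i\in[0,d]$, there exists a unique co-signotope $\tau\in\bar{\mathcal{S}}_p(n,d)$ whose p-sequence is $(c_0,\dots,c_d)$ and whose $+$-component decomposition is $\Delta(\tau)=(\tau_0,\dots,\tau_d)$.
   Context: $[a,b]=\{x\in\mathbb{Z}:a\le x\le b\}$, $[n]=[1,n]$. A $d$-subset of $[n]$ is written as its increasing tuple $B=(b_1,\dots,b_d)$. For a function $f$ on $d$-subsets of $[n]$, a $d$-subset $B$ and $j\in[d]$, let $B_j=B\setminus\{b_j\}$ and $[n]\setminus B_j=\{x_1<\dots<x_{n-d+1}\}$; the $(f,B,j)$-series is $(f(B_j\cup\{x_1\}),\dots,f(B_j\cup\{x_{n-d+1}\}))$, and for $f$ the identity it is called the $(B,j)$-series. For $0\le d<n$, a $d$-co-signotope on $n$ elements is a map $\tau:\binom{[n]}{d}\to\{+,-\}$ such that every $(\tau,B,j)$-series has at most one sign change; $+$-subsets are the $R$ with $\tau(R)=+$; $\bar{\mathcal{S}}_p(n,d)$ is the set of those with exactly $p$ $+$-subsets. The graph $G_{n,d}$ has the $d$-subsets of $[n]$ as vertices, two being adjacent if they are consecutive entries of some $(B,j)$-series;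 a $+$-component of $\tau$ is a connected component of the subgraph induced by the $+$-subsets. For $i\in[0,d]$, $S_{n,d,i}=\{1,\dots,i\}\cup\{n-d+i+1,\dots,n\}$, $\mathcal{C}^\tau_i$ is the $+$-component containing $S_{n,d,i}$ (empty if $\tau(S_{n,d,i})=-$), and $\bar{\mathcal{S}}_{c,i}(n,d)$ is the set of $\tau\in\bar{\mathcal{S}}_c(n,d)$ such that $\mathcal{C}^\tau_i$ is the only non-empty $+$-component. The p-sequence of $\tau$ is $(|\mathcal{C}^\tau_0|,\dots,|\mathcal{C}^\tau_d|)$. The $+$-component decomposition $\Delta(\tau)$ is the tuple $(\tau_0,\dots,\tau_d)$ of sign functions on $\binom{[n]}{d}$ with $\tau_i^{ -1}(+)=\mathcal{C}^\tau_i$. A sparse composition of $p$ (with $d+1$ parts) is a tuple $(c_0,\dots,c_d)$ of non-negative integers with $\sum_{i=0}^d c_i=p$ such that for every $i\in[1,d]$, $c_i=0$ or $c_{i-1}=0$. -}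

module Defs where

open import Data.Nat using (ℕ; zero; suc; _+_; _∸_; _≤_; _<_; _<ᵇ_; _≤ᵇ_)
open import Data.Bool using (Bool; true; false; _∨_)
open import Data.Fin using (Fin; toℕ; inject₁) renaming (suc to fsuc)
open import Data.Fin.Subset using (Subset; inside; outside; _∈_; _-_; ∣_∣)
open import Data.Vec using (Vec; tabulate; lookup; _[_]≔_)
import Data.Vec as V
open import Data.List using (List; []; _∷_; _++_; map; allFin; length)
open import Data.List.Membership.Propositional using () renaming (_∈_ to _∈ˡ_)
open import Data.List.Relation.Unary.Unique.Propositional using (Unique)
open import Data.Product using (Σ; ∃; _×_; _,_)
open import Data.Sum using (_⊎_)
open import Function.Bundles using (_⇔_)
open import Relation.Binary.PropositionalEquality using (_≡_)

data Sign : Set where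
  ⊕ ⊖ : Sign

-- Sign functions on subsets of [n] (only their values on d-subsets matter).
SignFn : ℕ → Set
SignFn n = Subset n → Sign

-- A d-subset of [n]: a subset (Fin n encodes [n], index k ↔ element k+1) of size d.
IsDSubset : ∀ {n} → ℕ → Subset n → Set
IsDSubset d R = ∣ R ∣ ≡ d

changes : List Sign → ℕ
changes [] = 0
changes (x ∷ []) = 0
changes (⊕ ∷ ⊕ ∷ r) = changes (⊕ ∷ r)
changes (⊖ ∷ ⊖ ∷ r) = changes (⊖ ∷ r)
changes (⊕ ∷ ⊖ ∷ r) = suc (changes (⊖ ∷ r))
changes (⊖ ∷ ⊕ ∷ r) = suc (changes (⊕ ∷ r))

outsideList : ∀ {n} → Subset n → List (Fin n)
outsideList {n} A = go (allFin n)
  where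
  go : List (Fin n) → List (Fin n)
  go [] = []
  go (x ∷ xs) with lookup A x
  ... | inside  = go xs
  ... | outside = x ∷ go xs

-- The (B,j)-series, where the j-th element b_j of B is given as b ∈ B:
-- with B_j = B \ {b}, the list (B_j ∪ {x_1}, …, B_j ∪ {x_{n-d+1}}).
series : ∀ {n} → Subset n → Fin n → List (Subset n)
series B b = map (λ x → Bj [ x ]≔ inside) (outsideList Bj)
  where Bj = B - b

IsCoSignotope : (n d : ℕ) → SignFn n → Set
IsCoSignotope n d τ =
  (B : Subset n) (b : Fin n) → IsDSubset d B → b ∈ B →
  changes (map τ (series B b)) ≤ 1

HasSize : ∀ {n} → (Subset n → Set) → ℕ → Set
HasSize {n} P k =
  Σ (List (Subset n)) λ L → Unique L × length L ≡ k × ((R : Subset n) → (R ∈ˡ L) ⇔ P R)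

Plus : ∀ {n} → ℕ → SignFn n → Subset n → Set
Plus d τ R = IsDSubset d R × τ R ≡ ⊕

InSbar : (n d p : ℕ) → SignFn n → Set
InSbar n d p τ = IsCoSignotope n d τ × HasSize (Plus d τ) p

-- Adjacency in G_{n,d}: consecutive entries of some (B,j)-series.
Consecutive : ∀ {n} → ℕ → Subset n → Subset n → Set
Consecutive {n} d R S =
  Σ (Subset n) λ B → Σ (Fin n) λ b → IsDSubset d B × b ∈ B ×
  Σ (List (Subset n)) λ xs → Σ (List (Subset n)) λ ys →
  series B b ≡ xs ++ (R ∷ S ∷ ys)

Adjacent : ∀ {n} → ℕ → Subset n → Subset n → Set
Adjacent d R S = Consecutive d R S ⊎ Consecutive d S R

-- R lies in the +-component of τ containing S (paths in G_{n,d} through +-subsets).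
data Reach {n : ℕ} (d : ℕ) (τ : SignFn n) (S : Subset n) : Subset n → Set where
  here : Plus d τ S → Reach d τ S S
  step : ∀ {R R'} → Reach d τ S R → Adjacent d R R' → Plus d τ R' → Reach d τ S R'

-- S_{n,d,i} = {1,…,i} ∪ {n-d+i+1,…,n}  (0-based: indices < i or ≥ n-d+i).
Sndi : (n d i : ℕ) → Subset n
Sndi n d i = tabulate λ x → (toℕ x <ᵇ i) ∨ ((n ∸ d + i) ≤ᵇ toℕ x)

Comp : (n d : ℕ) → SignFn n → Fin (suc d) → Subset n → Set
Comp n d τ i = Reach d τ (Sndi n d (toℕ i))

InSbarComp : (n d c : ℕ) → Fin (suc d) → SignFn n → Set
InSbarComp n d c i τ =
  InSbar n d c τ × ((R : Subset n) → Plus d τ R → Comp n d τ i R)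

IsPSeq : (n d : ℕ) → SignFn n → Vec ℕ (suc d) → Set
IsPSeq n d τ c = (i : Fin (suc d)) → HasSize (Comp n d τ i) (lookup c i)

IsSparseComposition : (p d : ℕ) → Vec ℕ (suc d) → Set
IsSparseComposition p d c =
  V.sum c ≡ p ×
  ((i : Fin d) → lookup c (fsuc i) ≡ 0 ⊎ lookup c (inject₁ i) ≡ 0)

IsDecomposition : (n d : ℕ) → SignFn n → (Fin (suc d) → SignFn n) → Set
IsDecomposition n d τ τs =
  (i : Fin (suc d)) (R : Subset n) → IsDSubset d R → (τs i R ≡ ⊕) ⇔ Comp n d τ i R

module Submission where

open import Defs
open import Data.Bool as Bool using (Bool; true; false; _∧_; _∨_; not; if_then_else_)
open import Data.Bool.Properties using (∨-zeroʳ; ∧-zeroʳ; ∧-distribʳ-∨; ¬-not; T-≡)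
open import Data.Empty using (⊥; ⊥-elim)
open import Data.Fin as F using (Fin; toℕ; inject₁; fromℕ<) renaming (zero to fzero; suc to fsuc)
import Data.Fin.Induction as FinInd
import Data.Fin.Properties as FP
open import Data.Fin.Subset using (Subset; inside; _-_; ∣_∣)
import Data.Fin.Subset.Properties as DSP
open import Data.List as List using (List; []; _∷_; _++_; map; length; filter; allFin)
open import Data.List.Membership.Propositional using (_∈_; find; lose)
open import Data.List.Membership.Propositional.Properties
  using (∈-map⁻; ∈-++⁺ˡ; ∈-++⁺ʳ; ∈-++⁻; ∈-∃++; ∈-filter⁺; ∈-filter⁻; ∈-concat⁺; ∈-concat⁻)
import Data.List.Properties as LP
open import Data.List.Relation.Binary.Sublist.Propositional using ([]; _∷_; _∷ʳ_; minimum) renaming (_⊆_ to _⊑_)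
open import Data.List.Relation.Binary.Sublist.Propositional.Properties using () renaming (map⁺ to ⊑-map⁺)
import Data.List.Relation.Unary.All as All
import Data.List.Relation.Unary.All.Properties as AllP
open import Data.List.Relation.Unary.AllPairs using ([]; _∷_)
import Data.List.Relation.Unary.AllPairs.Properties as AllPairsP
open import Data.List.Relation.Unary.Any as Any using (here; there)
import Data.List.Relation.Unary.Any.Properties as AnyP
open import Data.List.Relation.Unary.Unique.Propositional using (Unique)
import Data.List.Relation.Unary.Unique.Propositional.Properties as UP
open import Data.Nat
import Data.Nat.Induction as ℕInd
open import Data.Nat.Properties
open import Algebra.Properties.CommutativeSemigroup +-commutativeSemigroup
  using () renaming (interchange to +-interchange)
open import Data.Nat.Tactic.RingSolver using (solve-∀)
open import Data.Product using (Σ; ∃; ∃₂; _×_; _,_; proj₁; proj₂) renaming (map to Σ-map)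
open import Data.Sum using (_⊎_; inj₁; inj₂)
open import Data.Vec as V using (Vec; []; _∷_; lookup; tabulate; _[_]≔_)
import Data.Vec.Properties as VP
open import Function using (_∘_; id)
open import Function.Bundles using (Equivalence; mk⇔; _⇔_)
open import Induction.WellFounded using (Acc; acc)
open import Relation.Binary.Definitions using (Tri; tri<; tri≈; tri>)
open import Relation.Binary.PropositionalEquality
open import Relation.Nullary using (¬_; ¬?; Dec; yes; no; does; contradiction; _→-dec_; _×-dec_)
open import Relation.Nullary.Decidable using (decidable-stable; does-⇔; dec-true; dec-false)
open import Relation.Nullary.Reflects using (ofʸ; ofⁿ)

-- Let τ be a co-signotope with at most n - d +-subsets. For a +-subset R and e ∈ R the
-- (R,e)-series has n - d + 1 entries, one of them R itself, so it is not entirely +; having at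
-- most one sign change, it is + either everywhere below R (e is "Down") or everywhere above R.
-- Further counts of this kind show that adjacent +-subsets agree on the directions of their common
-- elements and that the exchanged element keeps its direction, so the number ι R of Down elements
-- is constant on +-components; it equals i at S_{n,d,i}. Conversely, moving an element of R to the
-- nearest free position in its direction stays in the +-component and decreases a potential, and a
-- +-subset admitting no such move is S_{n,d,ι R}. Hence every +-subset lies in C_{ι R}, the C_i are
-- told apart by ι, and C_i, C_{i+1} are never both non-empty: S_{n,d,i} and S_{n,d,i+1} differ by
-- one exchange but have different ι. For (2), the union τ of the τ_i is a co-signotope because a
-- series never meets +-subsets of two different τ_i: for indices at least two apart the same count,
-- now shared between τ_i and τ_j, exceeds n - d, and consecutive indices are excluded by sparseness.
-- Uniqueness holds because Δ(τ′) already determines the +-subsets of τ′.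

not≡true : ∀ {b} → not b ≡ true → b ≡ false
not≡true {false} _ = refl

∧-≡-true : ∀ {a b} → a ∧ b ≡ true → a ≡ true × b ≡ true
∧-≡-true {true} {true} _ = refl , refl

does≡true⇒ : ∀ {A : Set} (a? : Dec A) → does a? ≡ true → A
does≡true⇒ (yes a) _  = a
does≡true⇒ (no _)  ()

not-does≡true⇒¬ : ∀ {A : Set} (a? : Dec A) → not (does a?) ≡ true → ¬ A
not-does≡true⇒¬ (no ¬a) _  = ¬a
not-does≡true⇒¬ (yes _) ()

<ᵇ-true : ∀ {m k} → m < k → (m <ᵇ k) ≡ true
<ᵇ-true m<k = Equivalence.to T-≡ (<⇒<ᵇ m<k)

<ᵇ-true⁻ : ∀ {m k} → (m <ᵇ k) ≡ true → m < k
<ᵇ-true⁻ {m} {k} eq = <ᵇ⇒< m k (Equivalence.from T-≡ eq)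

≤ᵇ-true : ∀ {m k} → m ≤ k → (m ≤ᵇ k) ≡ true
≤ᵇ-true m≤k = Equivalence.to T-≡ (≤⇒≤ᵇ m≤k)

≤ᵇ-true⁻ : ∀ {m k} → (m ≤ᵇ k) ≡ true → m ≤ k
≤ᵇ-true⁻ {m} {k} eq = ≤ᵇ⇒≤ m k (Equivalence.from T-≡ eq)

≤ᵇ-total : ∀ m k → (m ≤ᵇ k) ∨ (k ≤ᵇ m) ≡ true
≤ᵇ-total m k with ≤-total m k
... | inj₁ m≤k rewrite ≤ᵇ-true m≤k = refl
... | inj₂ k≤m rewrite ≤ᵇ-true k≤m = ∨-zeroʳ _

<ᵇ-suc : ∀ m k → m ≢ k → (m <ᵇ k) ≡ (m <ᵇ suc k)
<ᵇ-suc zero    zero    m≢k = ⊥-elim (m≢k refl)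
<ᵇ-suc zero    (suc k) _   = refl
<ᵇ-suc (suc m) zero    _   = refl
<ᵇ-suc (suc m) (suc k) m≢k = <ᵇ-suc m k (m≢k ∘ cong suc)

≤ᵇ-suc : ∀ k m → k ≢ m → (k ≤ᵇ m) ≡ (suc k ≤ᵇ m)
≤ᵇ-suc k m k≢m with k ≤ᵇ m | ≤ᵇ-reflects-≤ k m | suc k ≤ᵇ m | ≤ᵇ-reflects-≤ (suc k) m
... | true  | _         | true  | _         = refl
... | false | _         | false | _         = refl
... | true  | ofʸ k≤m   | false | ofⁿ k≮m   = ⊥-elim (k≮m (≤∧≢⇒< k≤m k≢m))
... | false | ofⁿ k≰m   | true  | ofʸ k<m   = ⊥-elim (k≰m (<⇒≤ k<m))

consecutive-indices : ∀ {d} {i j : Fin (suc d)} → toℕ j ≡ suc (toℕ i) → ∃ λ (k : Fin d) → j ≡ fsuc k × i ≡ inject₁ k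
consecutive-indices {d} {i} {j} j≡1+i = k , FP.toℕ-injective (trans j≡1+i (cong suc (sym toℕ-k)))
                                          , FP.toℕ-injective (trans (sym toℕ-k) (sym (FP.toℕ-inject₁ k)))
  where
  i<d : toℕ i < d
  i<d = subst (_≤ d) j≡1+i (s≤s⁻¹ (FP.toℕ<n j))
  k : Fin d
  k = fromℕ< i<d
  toℕ-k : toℕ k ≡ toℕ i
  toℕ-k = FP.toℕ-fromℕ< i<d

-- Sums and counts over Fin

bit : Bool → ℕ
bit true  = 1
bit false = 0

bit≤1 : ∀ b → bit b ≤ 1
bit≤1 true  = ≤-refl
bit≤1 false = z≤n

∑ : ∀ {k} → (Fin k → ℕ) → ℕ
∑ {zero}  f = 0
∑ {suc k} f = f fzero + ∑ (f ∘ fsuc)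

count : ∀ {k} → (Fin k → Bool) → ℕ
count P = ∑ (bit ∘ P)

∑-cong : ∀ {k} {f g : Fin k → ℕ} → (∀ i → f i ≡ g i) → ∑ f ≡ ∑ g
∑-cong {zero}  h = refl
∑-cong {suc k} h = cong₂ _+_ (h fzero) (∑-cong (h ∘ fsuc))

∑-zero : ∀ k → ∑ {k} (λ _ → 0) ≡ 0
∑-zero zero    = refl
∑-zero (suc k) = ∑-zero k

∑-+ : ∀ {k} (f g : Fin k → ℕ) → ∑ (λ i → f i + g i) ≡ ∑ f + ∑ g
∑-+ {zero}  f g = refl
∑-+ {suc k} f g = trans (cong (f fzero + g fzero +_) (∑-+ (f ∘ fsuc) (g ∘ fsuc))) (+-interchange (f fzero) _ _ _)

-- Stated additively to avoid truncated subtraction.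
∑-update : ∀ {k} (f g : Fin k → ℕ) x → (∀ w → w ≢ x → f w ≡ g w) → ∑ f + g x ≡ ∑ g + f x
∑-update {suc k} f g fzero h
  rewrite ∑-cong {f = f ∘ fsuc} {g = g ∘ fsuc} (λ i → h (fsuc i) (λ ())) = swap-outer (f fzero) _ (g fzero)
  where
  swap-outer : ∀ a x b → a + x + b ≡ b + x + a
  swap-outer = solve-∀
∑-update {suc k} f g (fsuc x) h rewrite h fzero (λ ()) =
  trans (+-assoc (g fzero) _ _)
    (trans (cong (g fzero +_) (∑-update (f ∘ fsuc) (g ∘ fsuc) x (λ w w≢x → h (fsuc w) (w≢x ∘ FP.suc-injective))))
      (sym (+-assoc (g fzero) _ _)))

term≤∑ : ∀ {k} (f : Fin k → ℕ) i → f i ≤ ∑ f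
term≤∑ f fzero    = m≤m+n _ _
term≤∑ f (fsuc i) = ≤-trans (term≤∑ (f ∘ fsuc) i) (m≤n+m _ (f fzero))

two-terms≤∑ : ∀ {k} (f : Fin k → ℕ) i j → i ≢ j → f i + f j ≤ ∑ f
two-terms≤∑ f fzero    fzero    i≢j = ⊥-elim (i≢j refl)
two-terms≤∑ f fzero    (fsuc j) _   = +-monoʳ-≤ (f fzero) (term≤∑ (f ∘ fsuc) j)
two-terms≤∑ f (fsuc i) fzero    _   = subst (_≤ ∑ f) (+-comm (f fzero) _) (+-monoʳ-≤ (f fzero) (term≤∑ (f ∘ fsuc) i))
two-terms≤∑ f (fsuc i) (fsuc j) i≢j = ≤-trans (two-terms≤∑ (f ∘ fsuc) i j (i≢j ∘ cong fsuc)) (m≤n+m _ (f fzero))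

sum-tabulate : ∀ {k} (f : Fin k → ℕ) → V.sum (tabulate f) ≡ ∑ f
sum-tabulate {zero}  f = refl
sum-tabulate {suc k} f = cong (f fzero +_) (sum-tabulate (f ∘ fsuc))

count-cong : ∀ {k} {P Q : Fin k → Bool} → (∀ i → P i ≡ Q i) → count P ≡ count Q
count-cong P≗Q = ∑-cong (cong bit ∘ P≗Q)

count-≡ᵇ : ∀ {k} m → m < k → count {k} (λ i → m ≡ᵇ toℕ i) ≡ 1
count-≡ᵇ {suc k} zero    _         = cong suc (∑-zero k)
count-≡ᵇ {suc k} (suc m) (s≤s m<k) = count-≡ᵇ {k} m m<k

count-mono : ∀ {k} {P Q : Fin k → Bool} → (∀ i → P i ≡ true → Q i ≡ true) → count P ≤ count Q
count-mono {zero}          _   = z≤n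
count-mono {suc k} {P} {Q} P⇒Q = +-mono-≤ (bit-mono (P fzero) (Q fzero) (P⇒Q fzero)) (count-mono (P⇒Q ∘ fsuc))
  where
  bit-mono : ∀ a b → (a ≡ true → b ≡ true) → bit a ≤ bit b
  bit-mono false _ _   = z≤n
  bit-mono true  b a⇒b rewrite a⇒b refl = ≤-refl

count≥1 : ∀ {k} (P : Fin k → Bool) i → P i ≡ true → 1 ≤ count P
count≥1 P fzero    Pi rewrite Pi = s≤s z≤n
count≥1 P (fsuc i) Pi = ≤-trans (count≥1 (P ∘ fsuc) i Pi) (m≤n+m _ (bit (P fzero)))

count-update-≤ : ∀ {k} (P Q : Fin k → Bool) x → (∀ w → w ≢ x → P w ≡ Q w) → Q x ≡ false → count P ≤ count Q + 1
count-update-≤ P Q x P≗Q Qx≡false with ∑-update (bit ∘ P) (bit ∘ Q) x (λ w w≢x → cong bit (P≗Q w w≢x))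
... | eq rewrite Qx≡false = begin
  count P             ≡⟨ +-identityʳ _ ⟨
  count P + 0         ≡⟨ eq ⟩
  count Q + bit (P x) ≤⟨ +-monoʳ-≤ (count Q) (bit≤1 (P x)) ⟩
  count Q + 1         ∎
  where open ≤-Reasoning

count-<-witness : ∀ {k} (P Q : Fin k → Bool) → count P < count Q → ∃ λ i → Q i ≡ true × P i ≡ false
count-<-witness {suc k} P Q lt with P fzero in Pz | Q fzero in Qz
... | false | true  = fzero , Qz , Pz
... | true  | true  = Σ-map fsuc id (count-<-witness (P ∘ fsuc) (Q ∘ fsuc) (s≤s⁻¹ lt))
... | false | false = Σ-map fsuc id (count-<-witness (P ∘ fsuc) (Q ∘ fsuc) lt)
... | true  | false = Σ-map fsuc id (count-<-witness (P ∘ fsuc) (Q ∘ fsuc) (<-trans (n<1+n _) lt))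

count-complement : ∀ {k} (P : Fin k → Bool) → count P + count (not ∘ P) ≡ k
count-complement {zero}  P = refl
count-complement {suc k} P with P fzero
... | true  = cong suc (count-complement (P ∘ fsuc))
... | false = trans (+-suc _ _) (cong suc (count-complement (P ∘ fsuc)))

count-∨-∧ : ∀ {k} (P Q : Fin k → Bool) →
  count (λ i → P i ∨ Q i) + count (λ i → P i ∧ Q i) ≡ count P + count Q
count-∨-∧ {zero}  P Q = refl
count-∨-∧ {suc k} P Q with P fzero | Q fzero | count-∨-∧ (P ∘ fsuc) (Q ∘ fsuc)
... | true  | true  | ih = cong suc (trans (+-suc _ _) (trans (cong suc ih) (sym (+-suc _ _))))
... | true  | false | ih = cong suc ih
... | false | true  | ih = trans (cong suc ih) (sym (+-suc _ _))
... | false | false | ih = ih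

count-∧-split : ∀ {k} (P Q : Fin k → Bool) →
  count (λ i → P i ∧ Q i) + count (λ i → P i ∧ not (Q i)) ≡ count P
count-∧-split {zero}  P Q = refl
count-∧-split {suc k} P Q with P fzero | Q fzero | count-∧-split (P ∘ fsuc) (Q ∘ fsuc)
... | true  | true  | ih = cong suc ih
... | true  | false | ih = trans (+-suc _ _) (cong suc ih)
... | false | _     | ih = ih

count-below : ∀ {k} m → m ≤ k → count {k} (λ i → toℕ i <ᵇ m) ≡ m
count-below {zero}  zero    _         = refl
count-below {suc k} zero    _         = count-below {k} 0 z≤n
count-below {suc k} (suc m) (s≤s m≤k) = cong suc (count-below m m≤k)

count-from : ∀ {k} m → count {k} (λ i → m ≤ᵇ toℕ i) ≡ k ∸ m
count-from {zero}  zero          = refl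
count-from {zero}  (suc m)       = refl
count-from {suc k} zero          = cong suc (count-from {k} 0)
count-from {suc k} (suc zero)    = count-from {k} 0
count-from {suc k} (suc (suc m)) = count-from {k} (suc m)

Unique⇒length≤ : ∀ {A : Set} {xs ys : List A} → Unique xs → (∀ {x} → x ∈ xs → x ∈ ys) → length xs ≤ length ys
Unique⇒length≤ {xs = []}     _          _     = z≤n
Unique⇒length≤ {xs = x ∷ xs} (x∉xs ∷ u) xs⊆ys with ∈-∃++ (xs⊆ys (here refl))
... | ys₁ , ys₂ , refl = begin
  suc (length xs)              ≤⟨ s≤s (Unique⇒length≤ u xs⊆ys₁ys₂) ⟩
  suc (length (ys₁ ++ ys₂))    ≡⟨ cong suc (LP.length-++ ys₁) ⟩
  suc (length ys₁ + length ys₂) ≡⟨ +-suc (length ys₁) _ ⟨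
  length ys₁ + length (x ∷ ys₂) ≡⟨ LP.length-++ ys₁ ⟨
  length (ys₁ ++ x ∷ ys₂)      ∎
  where
  open ≤-Reasoning
  xs⊆ys₁ys₂ : ∀ {y} → y ∈ xs → y ∈ ys₁ ++ ys₂
  xs⊆ys₁ys₂ y∈xs with ∈-++⁻ ys₁ (xs⊆ys (there y∈xs))
  ... | inj₁ y∈ys₁         = ∈-++⁺ˡ y∈ys₁
  ... | inj₂ (here refl)   = ⊥-elim (All.lookup x∉xs y∈xs refl)
  ... | inj₂ (there y∈ys₂) = ∈-++⁺ʳ ys₁ y∈ys₂

Unique-map-on : ∀ {A B : Set} (f : A → B) {xs : List A} → Unique xs →
  (∀ {x y} → x ∈ xs → y ∈ xs → f x ≡ f y → x ≡ y) → Unique (map f xs)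
Unique-map-on f {[]}     []         _   = []
Unique-map-on f {x ∷ xs} (x∉xs ∷ u) inj =
  All.tabulate fx∉ ∷ Unique-map-on f u (λ x∈ y∈ → inj (there x∈) (there y∈))
  where
  fx∉ : ∀ {z} → z ∈ map f xs → f x ≢ z
  fx∉ z∈ fx≡z with ∈-map⁻ f z∈
  ... | y , y∈xs , refl = All.lookup x∉xs y∈xs (inj (here refl) (there y∈xs) fx≡z)

∑-length-filter : ∀ {A : Set} {k} (g : A → ℕ) (L : List A) → (∀ {x} → x ∈ L → g x < k) →
  ∑ {k} (λ i → length (filter (λ x → g x ≟ toℕ i) L)) ≡ length L
∑-length-filter {k = k} g []      _   = ∑-zero k
∑-length-filter {k = k} g (x ∷ L) g<k = begin
  ∑ {k} (λ i → length (filter (λ y → g y ≟ toℕ i) (x ∷ L)))                ≡⟨ ∑-cong length-filter-∷ ⟩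
  ∑ {k} (λ i → bit (g x ≡ᵇ toℕ i) + length (filter (λ y → g y ≟ toℕ i) L)) ≡⟨ ∑-+ {k} _ _ ⟩
  count {k} (λ i → g x ≡ᵇ toℕ i) + ∑ {k} (λ i → length (filter (λ y → g y ≟ toℕ i) L))
      ≡⟨ cong₂ _+_ (count-≡ᵇ (g x) (g<k (here refl))) (∑-length-filter g L (g<k ∘ there)) ⟩
  suc (length L)                                                            ∎
  where
  open ≡-Reasoning
  length-filter-∷ : ∀ (i : Fin k) →
    length (filter (λ y → g y ≟ toℕ i) (x ∷ L)) ≡ bit (g x ≡ᵇ toℕ i) + length (filter (λ y → g y ≟ toℕ i) L)
  length-filter-∷ i with g x ≡ᵇ toℕ i
  ... | true  = refl
  ... | false = refl

length-concat-tabulate : ∀ {A : Set} {k} (f : Fin k → List A) → length (List.concat (List.tabulate f)) ≡ ∑ (length ∘ f)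
length-concat-tabulate {k = zero}  f = refl
length-concat-tabulate {k = suc k} f =
  trans (LP.length-++ (f fzero)) (cong (length (f fzero) +_) (length-concat-tabulate (f ∘ fsuc)))

trues : ∀ {k} → (Fin k → Bool) → List (Fin k)
trues {zero}  P = []
trues {suc k} P with P fzero
... | true  = fzero ∷ map fsuc (trues (P ∘ fsuc))
... | false = map fsuc (trues (P ∘ fsuc))

length-trues : ∀ {k} (P : Fin k → Bool) → length (trues P) ≡ count P
length-trues {zero}  P = refl
length-trues {suc k} P with P fzero
... | true  = cong suc (trans (LP.length-map fsuc (trues (P ∘ fsuc))) (length-trues (P ∘ fsuc)))
... | false = trans (LP.length-map fsuc (trues (P ∘ fsuc))) (length-trues (P ∘ fsuc))

∈-trues⁻ : ∀ {k} (P : Fin k → Bool) {i} → i ∈ trues P → P i ≡ true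
∈-trues⁻ {suc k} P i∈ with P fzero in P0 | i∈
... | true  | here refl = P0
... | true  | there i∈′ = ∈-suc-trues i∈′
  where
  ∈-suc-trues : ∀ {i} → i ∈ map fsuc (trues (P ∘ fsuc)) → P i ≡ true
  ∈-suc-trues i∈ with ∈-map⁻ fsuc i∈
  ... | j , j∈ , refl = ∈-trues⁻ (P ∘ fsuc) j∈
... | false | i∈′ with ∈-map⁻ fsuc i∈′
...   | j , j∈ , refl = ∈-trues⁻ (P ∘ fsuc) j∈

Unique-trues : ∀ {k} (P : Fin k → Bool) → Unique (trues P)
Unique-trues {zero}  P = []
Unique-trues {suc k} P with P fzero
... | true  = All.tabulate zero∉ ∷ Unique-map-on fsuc (Unique-trues (P ∘ fsuc)) (λ _ _ → FP.suc-injective)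
  where
  zero∉ : ∀ {z} → z ∈ map fsuc (trues (P ∘ fsuc)) → fzero ≢ z
  zero∉ z∈ 0≡z with ∈-map⁻ fsuc z∈
  zero∉ z∈ () | _ , _ , refl
... | false = Unique-map-on fsuc (Unique-trues (P ∘ fsuc)) (λ _ _ → FP.suc-injective)

count≤length : ∀ {k} {A : Set} (P : Fin k → Bool) (h : Fin k → A) (L : List A) →
  (∀ z → P z ≡ true → h z ∈ L) →
  (∀ z z′ → P z ≡ true → P z′ ≡ true → h z ≡ h z′ → z ≡ z′) →
  count P ≤ length L
count≤length P h L h∈L h-inj = begin
  count P                   ≡⟨ length-trues P ⟨
  length (trues P)          ≡⟨ LP.length-map h (trues P) ⟨
  length (map h (trues P))  ≤⟨ Unique⇒length≤ unique image⊆L ⟩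
  length L                  ∎
  where
  open ≤-Reasoning
  unique : Unique (map h (trues P))
  unique = Unique-map-on h (Unique-trues P) (λ z∈ z′∈ → h-inj _ _ (∈-trues⁻ P z∈) (∈-trues⁻ P z′∈))
  image⊆L : ∀ {x} → x ∈ map h (trues P) → x ∈ L
  image⊆L x∈ with ∈-map⁻ h x∈
  ... | z , z∈ , refl = h∈L z (∈-trues⁻ P z∈)

module _ {k : ℕ} (P : Fin (suc k) → Bool) where

  ⊑-trues-skip : ∀ {xs} → xs ⊑ map fsuc (trues (P ∘ fsuc)) → xs ⊑ trues P
  ⊑-trues-skip xs⊑ with P fzero
  ... | true  = fzero ∷ʳ xs⊑
  ... | false = xs⊑

  ⊑-trues-keep : ∀ {xs} → P fzero ≡ true → xs ⊑ map fsuc (trues (P ∘ fsuc)) → (fzero ∷ xs) ⊑ trues P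
  ⊑-trues-keep P0 xs⊑ with P fzero
  ⊑-trues-keep refl xs⊑ | true = refl ∷ xs⊑

[y]⊑trues : ∀ {k} (P : Fin k → Bool) y → P y ≡ true → (y ∷ []) ⊑ trues P
[y]⊑trues {suc k} P fzero    Py = ⊑-trues-keep P Py (minimum _)
[y]⊑trues {suc k} P (fsuc y) Py = ⊑-trues-skip P (⊑-map⁺ fsuc ([y]⊑trues (P ∘ fsuc) y Py))

[y,w]⊑trues : ∀ {k} (P : Fin k → Bool) y w → y F.< w → P y ≡ true → P w ≡ true → (y ∷ w ∷ []) ⊑ trues P
[y,w]⊑trues {suc k} P fzero    (fsuc w) _   Py Pw = ⊑-trues-keep P Py (⊑-map⁺ fsuc ([y]⊑trues (P ∘ fsuc) w Pw))
[y,w]⊑trues {suc k} P (fsuc y) (fsuc w) y<w Py Pw =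
  ⊑-trues-skip P (⊑-map⁺ fsuc ([y,w]⊑trues (P ∘ fsuc) y w (s≤s⁻¹ y<w) Py Pw))

[y,w,z]⊑trues : ∀ {k} (P : Fin k → Bool) y w z → y F.< w → w F.< z →
  P y ≡ true → P w ≡ true → P z ≡ true → (y ∷ w ∷ z ∷ []) ⊑ trues P
[y,w,z]⊑trues {suc k} P fzero    (fsuc w) (fsuc z) _   w<z Py Pw Pz =
  ⊑-trues-keep P Py (⊑-map⁺ fsuc ([y,w]⊑trues (P ∘ fsuc) w z (s≤s⁻¹ w<z) Pw Pz))
[y,w,z]⊑trues {suc k} P (fsuc y) (fsuc w) (fsuc z) y<w w<z Py Pw Pz =
  ⊑-trues-skip P (⊑-map⁺ fsuc ([y,w,z]⊑trues (P ∘ fsuc) y w z (s≤s⁻¹ y<w) (s≤s⁻¹ w<z) Py Pw Pz))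

trues-first : ∀ {k} (P : Fin k → Bool) w → P w ≡ true → (∀ v → v F.< w → P v ≡ false) →
  ∃ λ ys → trues P ≡ w ∷ ys
trues-first {suc k} P fzero Pw _ with P fzero
trues-first {suc k} P fzero refl _ | true = _ , refl
trues-first {suc k} P (fsuc w) Pw none-below with P fzero in P0
... | true  = contradiction (trans (sym P0) (none-below fzero (s≤s z≤n))) λ ()
... | false with trues-first (P ∘ fsuc) w Pw (λ v v<w → none-below (fsuc v) (s≤s v<w))
...   | ys , eq = map fsuc ys , cong (map fsuc) eq

trues-consecutive : ∀ {k} (P : Fin k → Bool) y w → y F.< w → P y ≡ true → P w ≡ true →
  (∀ v → y F.< v → v F.< w → P v ≡ false) →
  ∃₂ λ xs ys → trues P ≡ xs ++ y ∷ w ∷ ys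
trues-consecutive {suc k} P fzero (fsuc w) _ Py Pw none-between with P fzero
trues-consecutive {suc k} P fzero (fsuc w) _ refl Pw none-between | true
  with trues-first (P ∘ fsuc) w Pw (λ v v<w → none-between (fsuc v) (s≤s z≤n) (s≤s v<w))
... | ys , eq = [] , map fsuc ys , cong (fzero ∷_) (cong (map fsuc) eq)
trues-consecutive {suc k} P (fsuc y) (fsuc w) y<w Py Pw none-between
  with trues-consecutive (P ∘ fsuc) y w (s≤s⁻¹ y<w) Py Pw (λ v y<v v<w → none-between (fsuc v) (s≤s y<v) (s≤s v<w))
... | xs , ys , eq with P fzero
...   | true  = fzero ∷ map fsuc xs , map fsuc ys , cong (fzero ∷_) (trans (cong (map fsuc) eq) (LP.map-++ fsuc xs _))
...   | false = map fsuc xs , map fsuc ys , trans (cong (map fsuc) eq) (LP.map-++ fsuc xs _)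

-- Sign changes

_≟ˢ_ : (s t : Sign) → Dec (s ≡ t)
⊕ ≟ˢ ⊕ = yes refl
⊖ ≟ˢ ⊖ = yes refl
⊕ ≟ˢ ⊖ = no λ ()
⊖ ≟ˢ ⊕ = no λ ()

differ : Sign → Sign → ℕ
differ ⊕ ⊕ = 0
differ ⊖ ⊖ = 0
differ ⊕ ⊖ = 1
differ ⊖ ⊕ = 1

changesFrom : Sign → List Sign → ℕ
changesFrom a []      = 0
changesFrom a (b ∷ r) = differ a b + changesFrom b r

changes-∷ : ∀ a r → changes (a ∷ r) ≡ changesFrom a r
changes-∷ a [] = refl
changes-∷ ⊕ (⊕ ∷ r) = changes-∷ ⊕ r
changes-∷ ⊕ (⊖ ∷ r) = cong suc (changes-∷ ⊖ r)
changes-∷ ⊖ (⊕ ∷ r) = cong suc (changes-∷ ⊕ r)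
changes-∷ ⊖ (⊖ ∷ r) = changes-∷ ⊖ r

differ-triangle : ∀ a b c → differ a c ≤ differ a b + differ b c
differ-triangle ⊕ ⊕ ⊕ = z≤n
differ-triangle ⊕ ⊕ ⊖ = s≤s z≤n
differ-triangle ⊕ ⊖ ⊕ = z≤n
differ-triangle ⊕ ⊖ ⊖ = s≤s z≤n
differ-triangle ⊖ ⊕ ⊕ = s≤s z≤n
differ-triangle ⊖ ⊕ ⊖ = z≤n
differ-triangle ⊖ ⊖ ⊕ = s≤s z≤n
differ-triangle ⊖ ⊖ ⊖ = z≤n

changesFrom-skip : ∀ a b r → changesFrom a r ≤ differ a b + changesFrom b r
changesFrom-skip a b []      = z≤n
changesFrom-skip a b (c ∷ r) =
  ≤-trans (+-monoˡ-≤ (changesFrom c r) (differ-triangle a b c)) (≤-reflexive (+-assoc (differ a b) _ _))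

changesFrom-mono : ∀ a {xs ys} → xs ⊑ ys → changesFrom a xs ≤ changesFrom a ys
changesFrom-mono a []                 = z≤n
changesFrom-mono a (_∷ʳ_ {ys = ys} b p) = ≤-trans (changesFrom-mono a p) (changesFrom-skip a b ys)
changesFrom-mono a (_∷_ {x = b} refl p) = +-monoʳ-≤ (differ a b) (changesFrom-mono b p)

changes-mono : ∀ {xs ys} → xs ⊑ ys → changes xs ≤ changes ys
changes-mono {[]}    _ = z≤n
changes-mono {x ∷ xs} {y ∷ ys} (y ∷ʳ p) = ≤-trans (changes-mono p) (changes≤changes-∷ ys)
  where
  changes≤changes-∷ : ∀ zs → changes zs ≤ changes (y ∷ zs)
  changes≤changes-∷ []      = z≤n
  changes≤changes-∷ (z ∷ zs) =
    subst₂ _≤_ (sym (changes-∷ z zs)) (sym (changes-∷ y (z ∷ zs))) (m≤n+m _ (differ y z))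
changes-mono {x ∷ xs} {x ∷ ys} (refl ∷ p) =
  subst₂ _≤_ (sym (changes-∷ x xs)) (sym (changes-∷ x ys)) (changesFrom-mono x p)

one-change⇒middle : ∀ a b → changes (a ∷ b ∷ a ∷ []) ≤ 1 → b ≡ a
one-change⇒middle ⊕ ⊕ _ = refl
one-change⇒middle ⊖ ⊖ _ = refl
one-change⇒middle ⊕ ⊖ (s≤s ())
one-change⇒middle ⊖ ⊕ (s≤s ())

-- Subsets, exchanges and series

add : ∀ {n} → Subset n → Fin n → Subset n
add C x = C [ x ]≔ inside

module _ {n : ℕ} where

  subset-ext : {A B : Subset n} → (∀ i → lookup A i ≡ lookup B i) → A ≡ B
  subset-ext {A} {B} h = trans (sym (VP.tabulate∘lookup A)) (trans (VP.tabulate-cong h) (VP.tabulate∘lookup B))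

  lookup-add-same : ∀ (C : Subset n) x → lookup (add C x) x ≡ true
  lookup-add-same C x = VP.lookup∘update x C inside

  lookup-add-other : ∀ (C : Subset n) x w → w ≢ x → lookup (add C x) w ≡ lookup C w
  lookup-add-other C x w w≢x = VP.lookup∘update′ w≢x C inside

  lookup-add-inside : ∀ (C : Subset n) x w → lookup C w ≡ true → lookup (add C x) w ≡ true
  lookup-add-inside C x w w∈C with w FP.≟ x
  ... | yes refl = lookup-add-same C x
  ... | no w≢x   = trans (lookup-add-other C x w w≢x) w∈C

lookup-minus-same : ∀ {n} (B : Subset n) b → lookup (B - b) b ≡ false
lookup-minus-same (_ ∷ B) fzero    = refl
lookup-minus-same (_ ∷ B) (fsuc b) = lookup-minus-same B b

lookup-minus-other : ∀ {n} (B : Subset n) b i → i ≢ b → lookup (B - b) i ≡ lookup B i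
lookup-minus-other (x ∷ B) fzero    fzero    i≢b = ⊥-elim (i≢b refl)
lookup-minus-other (x ∷ B) fzero    (fsuc i) _   = cong (λ C → lookup C i) (DSP.p─⊥≡p B)
lookup-minus-other (true ∷ B)  (fsuc b) fzero    _   = refl
lookup-minus-other (false ∷ B) (fsuc b) fzero    _   = refl
lookup-minus-other (x ∷ B) (fsuc b) (fsuc i) i≢b = lookup-minus-other B b i (i≢b ∘ cong fsuc)

module _ {n : ℕ} where

  lookup-minus-outside : ∀ (R : Subset n) e y → lookup R y ≡ false → lookup (R - e) y ≡ false
  lookup-minus-outside R e y y∉R with y FP.≟ e
  ... | yes refl = lookup-minus-same R e
  ... | no y≢e   = trans (lookup-minus-other R e y y≢e) y∉R

  lookup-minus-outside⁻ : ∀ (R : Subset n) e y → y ≢ e → lookup (R - e) y ≡ false → lookup R y ≡ false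
  lookup-minus-outside⁻ R e y y≢e y∉ = trans (sym (lookup-minus-other R e y y≢e)) y∉

  add-minus-self : ∀ (B : Subset n) b → lookup B b ≡ true → add (B - b) b ≡ B
  add-minus-self B b b∈B = subset-ext lookup-eq
    where
    lookup-eq : ∀ i → lookup (add (B - b) b) i ≡ lookup B i
    lookup-eq i with i FP.≟ b
    ... | yes refl = trans (lookup-add-same (B - b) b) (sym b∈B)
    ... | no i≢b   = trans (lookup-add-other (B - b) b i i≢b) (lookup-minus-other B b i i≢b)

  minus-add-self : ∀ (C : Subset n) x → lookup C x ≡ false → add C x - x ≡ C
  minus-add-self C x x∉C = subset-ext lookup-eq
    where
    lookup-eq : ∀ i → lookup (add C x - x) i ≡ lookup C i
    lookup-eq i with i FP.≟ x
    ... | yes refl = trans (lookup-minus-same (add C x) x) (sym x∉C)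
    ... | no i≢x   = trans (lookup-minus-other (add C x) x i i≢x) (lookup-add-other C x i i≢x)

∣∣≡count : ∀ {n} (B : Subset n) → ∣ B ∣ ≡ count (lookup B)
∣∣≡count []          = refl
∣∣≡count (true ∷ B)  = cong suc (∣∣≡count B)
∣∣≡count (false ∷ B) = ∣∣≡count B

module _ {n : ℕ} where

  count-add : ∀ (C : Subset n) x → lookup C x ≡ false → count (lookup (add C x)) ≡ suc (count (lookup C))
  count-add C x x∉C
    with ∑-update (bit ∘ lookup C) (bit ∘ lookup (add C x)) x (λ w w≢x → cong bit (sym (lookup-add-other C x w w≢x)))
  ... | eq rewrite x∉C | lookup-add-same C x = trans (sym (+-identityʳ _)) (trans (sym eq) (+-comm _ 1))

  ∑-over-add : ∀ (C : Subset n) x → lookup C x ≡ false → (f : Fin n → ℕ) →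
    ∑ (λ e → if lookup (add C x) e then f e else 0) ≡ ∑ (λ e → if lookup C e then f e else 0) + f x
  ∑-over-add C x x∉C f
    with ∑-update (λ e → if lookup C e then f e else 0) (λ e → if lookup (add C x) e then f e else 0) x
                  (λ e e≢x → cong (λ b → if b then f e else 0) (sym (lookup-add-other C x e e≢x)))
  ... | eq rewrite x∉C | lookup-add-same C x = sym (trans eq (+-identityʳ _))

  count-∧-add : ∀ (C : Subset n) x → lookup C x ≡ false → (P : Fin n → Bool) →
    count (λ e → lookup (add C x) e ∧ P e) ≡ count (λ e → lookup C e ∧ P e) + bit (P x)
  count-∧-add C x x∉C P
    with ∑-update (λ e → bit (lookup C e ∧ P e)) (λ e → bit (lookup (add C x) e ∧ P e)) x
                  (λ e e≢x → cong (λ b → bit (b ∧ P e)) (sym (lookup-add-other C x e e≢x)))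
  ... | eq rewrite x∉C | lookup-add-same C x = sym (trans eq (+-identityʳ _))

  count-minus : ∀ (B : Subset n) b → lookup B b ≡ true → suc (count (lookup (B - b))) ≡ count (lookup B)
  count-minus B b b∈B
    with ∑-update (bit ∘ lookup (B - b)) (bit ∘ lookup B) b (λ w w≢b → cong bit (lookup-minus-other B b w w≢b))
  ... | eq rewrite b∈B | lookup-minus-same B b = trans (+-comm 1 _) (trans eq (+-identityʳ _))

suc-count-minus≡d : ∀ {n d} (R : Subset n) e → IsDSubset d R → lookup R e ≡ true → suc (count (lookup (R - e))) ≡ d
suc-count-minus≡d R e ∣R∣≡d e∈R = trans (count-minus R e e∈R) (trans (sym (∣∣≡count R)) ∣R∣≡d)

exchange : ∀ {n} → Subset n → Fin n → Fin n → Subset n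
exchange R e y = add (R - e) y

module _ {n : ℕ} where

  lookup-exchange-new : ∀ (R : Subset n) e y → lookup (exchange R e y) y ≡ true
  lookup-exchange-new R e y = lookup-add-same (R - e) y

  lookup-exchange-old : ∀ (R : Subset n) e y → y ≢ e → lookup (exchange R e y) e ≡ false
  lookup-exchange-old R e y y≢e = trans (lookup-add-other (R - e) y e (y≢e ∘ sym)) (lookup-minus-same R e)

  lookup-exchange-other : ∀ (R : Subset n) e y w → w ≢ y → w ≢ e → lookup (exchange R e y) w ≡ lookup R w
  lookup-exchange-other R e y w w≢y w≢e = trans (lookup-add-other (R - e) y w w≢y) (lookup-minus-other R e w w≢e)

  lookup-exchange-inside : ∀ (R : Subset n) e y w → w ≢ e → lookup R w ≡ true → lookup (exchange R e y) w ≡ true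
  lookup-exchange-inside R e y w w≢e w∈R =
    lookup-add-inside (R - e) y w (trans (lookup-minus-other R e w w≢e) w∈R)

  exchange-injective : ∀ (R : Subset n) e {z z′} → lookup (R - e) z ≡ false → exchange R e z ≡ exchange R e z′ → z ≡ z′
  exchange-injective R e {z} {z′} z∉ eq with z FP.≟ z′
  ... | yes z≡z′ = z≡z′
  ... | no z≢z′  = contradiction (begin
    true                         ≡⟨ lookup-exchange-new R e z ⟨
    lookup (exchange R e z) z    ≡⟨ cong (λ V → lookup V z) eq ⟩
    lookup (exchange R e z′) z   ≡⟨ lookup-add-other (R - e) z′ z z≢z′ ⟩
    lookup (R - e) z             ≡⟨ z∉ ⟩
    false                        ∎) λ ()
    where open ≡-Reasoning

  ∣exchange∣ : ∀ {d} (R : Subset n) e z → IsDSubset d R → lookup R e ≡ true → lookup (R - e) z ≡ false →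
    IsDSubset d (exchange R e z)
  ∣exchange∣ {d} R e z ∣R∣≡d e∈R z∉ = begin
    ∣ exchange R e z ∣                 ≡⟨ ∣∣≡count (exchange R e z) ⟩
    count (lookup (exchange R e z))    ≡⟨ count-add (R - e) z z∉ ⟩
    suc (count (lookup (R - e)))       ≡⟨ count-minus R e e∈R ⟩
    count (lookup R)                   ≡⟨ ∣∣≡count R ⟨
    ∣ R ∣                              ≡⟨ ∣R∣≡d ⟩
    d                                  ∎
    where open ≡-Reasoning

data Siblings {n : ℕ} : Subset n → Subset n → Set where
  siblings : ∀ C x x′ → lookup C x ≡ false → lookup C x′ ≡ false → Siblings (add C x) (add C x′)

Siblings-sym : ∀ {n} {R S : Subset n} → Siblings R S → Siblings S R
Siblings-sym (siblings C x x′ x∉C x′∉C) = siblings C x′ x x′∉C x∉C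

Siblings-refl : ∀ {n} (R : Subset n) e → lookup R e ≡ true → Siblings R R
Siblings-refl R e e∈R = subst₂ Siblings (add-minus-self R e e∈R) (add-minus-self R e e∈R)
  (siblings (R - e) e e (lookup-minus-same R e) (lookup-minus-same R e))

module _ {n : ℕ} (R : Subset n) where

  FilledBetween : Fin n → Fin n → Set
  FilledBetween u w = ∀ v → u F.< v → v F.< w → lookup R v ≡ true

  outside-between? : ∀ (u w v : Fin n) → Dec (u F.< v × v F.< w × lookup R v ≡ false)
  outside-between? u w v = u F.<? v ×-dec v F.<? w ×-dec lookup R v Bool.≟ false

  nearest-outside-below : ∀ {y w : Fin n} → y F.< w → lookup R y ≡ false →
    ∃ λ y* → y* F.< w × lookup R y* ≡ false × FilledBetween y* w
  nearest-outside-below {y} {w} = search y (FinInd.>-wellFounded y)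
    where
    search : ∀ y → Acc (F._>_ {n}) y → y F.< w → lookup R y ≡ false →
      ∃ λ y* → y* F.< w × lookup R y* ≡ false × FilledBetween y* w
    search y (acc larger) y<w y∉R with FP.any? (outside-between? y w)
    ... | yes (v , y<v , v<w , v∉R) = search v (larger y<v) v<w v∉R
    ... | no ¬between = y , y<w , y∉R , λ v y<v v<w → ¬-not (λ v∉R → ¬between (v , y<v , v<w , v∉R))

  nearest-outside-above : ∀ {w z : Fin n} → w F.< z → lookup R z ≡ false →
    ∃ λ z* → w F.< z* × lookup R z* ≡ false × FilledBetween w z*
  nearest-outside-above {w} {z} = search z (FinInd.<-wellFounded z)
    where
    search : ∀ z → Acc (F._<_ {n}) z → w F.< z → lookup R z ≡ false →
      ∃ λ z* → w F.< z* × lookup R z* ≡ false × FilledBetween w z*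
    search z (acc smaller) w<z z∉R with FP.any? (outside-between? w z)
    ... | yes (v , w<v , v<z , v∉R) = search v (smaller v<z) w<v v∉R
    ... | no ¬between = z , w<z , z∉R , λ v w<v v<z → ¬-not (λ v∉R → ¬between (v , w<v , v<z , v∉R))

-- The local function `go` of `outsideList` cannot be referred to by name:
-- the meta below is solved to it by unification in `outsideFrom-allFin`.
mutual
  outsideFrom : ∀ {n} → Subset n → List (Fin n) → List (Fin n)
  outsideFrom A = _

  outsideFrom-allFin : ∀ {n} (A : Subset n) → outsideFrom A (allFin n) ≡ outsideList A
  outsideFrom-allFin {n} A with allFin n
  ... | L = refl

outsideFrom-map-suc : ∀ {n} b (A : Subset n) L → outsideFrom (b ∷ A) (map fsuc L) ≡ map fsuc (outsideFrom A L)
outsideFrom-map-suc b A []      = refl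
outsideFrom-map-suc b A (x ∷ L) with lookup A x
... | true  = outsideFrom-map-suc b A L
... | false = cong (fsuc x ∷_) (outsideFrom-map-suc b A L)

outsideList≡trues : ∀ {n} (A : Subset n) → outsideList A ≡ trues (not ∘ lookup A)

outsideFrom-allFin-suc : ∀ {n} b (A : Subset n) →
  outsideFrom (b ∷ A) (List.tabulate fsuc) ≡ map fsuc (trues (not ∘ lookup A))
outsideFrom-allFin-suc {n} b A = begin
  outsideFrom (b ∷ A) (List.tabulate fsuc)    ≡⟨ cong (outsideFrom (b ∷ A)) (LP.map-tabulate id fsuc) ⟨
  outsideFrom (b ∷ A) (map fsuc (allFin n))    ≡⟨ outsideFrom-map-suc b A (allFin n) ⟩
  map fsuc (outsideFrom A (allFin n))          ≡⟨ cong (map fsuc) (trans (outsideFrom-allFin A) (outsideList≡trues A)) ⟩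
  map fsuc (trues (not ∘ lookup A))            ∎
  where open ≡-Reasoning

outsideList≡trues {zero}  []          = refl
outsideList≡trues {suc n} (true ∷ A)  = trans (sym (outsideFrom-allFin (true ∷ A))) (outsideFrom-allFin-suc true A)
outsideList≡trues {suc n} (false ∷ A) =
  trans (sym (outsideFrom-allFin (false ∷ A))) (cong (fzero ∷_) (outsideFrom-allFin-suc false A))

module _ {n : ℕ} (B : Subset n) (b : Fin n) where

  series≡ : series B b ≡ map (add (B - b)) (trues (not ∘ lookup (B - b)))
  series≡ = cong (map (add (B - b))) (outsideList≡trues (B - b))

  ∈-series⁻ : ∀ {R} → R ∈ series B b → ∃ λ x → lookup (B - b) x ≡ false × R ≡ add (B - b) x
  ∈-series⁻ {R} R∈ with ∈-map⁻ (add (B - b)) (subst (R ∈_) series≡ R∈)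
  ... | x , x∈ , R≡ = x , not≡true (∈-trues⁻ _ x∈) , R≡

  ∈-series⇒Siblings : ∀ {R R′} → R ∈ series B b → R′ ∈ series B b → Siblings R R′
  ∈-series⇒Siblings R∈ R′∈ with ∈-series⁻ R∈ | ∈-series⁻ R′∈
  ... | x , x∉ , refl | x′ , x′∉ , refl = siblings (B - b) x x′ x∉ x′∉

  ∈-series⇒IsDSubset : ∀ {d} → IsDSubset d B → lookup B b ≡ true → ∀ {R} → R ∈ series B b → IsDSubset d R
  ∈-series⇒IsDSubset ∣B∣≡d b∈B R∈ with ∈-series⁻ R∈
  ... | x , x∉ , refl = ∣exchange∣ B b x ∣B∣≡d b∈B x∉

module _ {n d : ℕ} where

  Consecutive⇒Siblings : {R S : Subset n} → Consecutive d R S → Siblings R S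
  Consecutive⇒Siblings (B , b , _ , _ , xs , ys , eq) =
    ∈-series⇒Siblings B b (subst (_ ∈_) (sym eq) (∈-++⁺ʳ xs (here refl)))
                          (subst (_ ∈_) (sym eq) (∈-++⁺ʳ xs (there (here refl))))

  Adjacent⇒Siblings : {R S : Subset n} → Adjacent d R S → Siblings R S
  Adjacent⇒Siblings (inj₁ R~S) = Consecutive⇒Siblings R~S
  Adjacent⇒Siblings (inj₂ S~R) = Siblings-sym (Consecutive⇒Siblings S~R)

  series-consecutive : ∀ (B : Subset n) b → IsDSubset d B → lookup B b ≡ true → ∀ {y w} → y F.< w →
    lookup (B - b) y ≡ false → lookup (B - b) w ≡ false → (∀ v → y F.< v → v F.< w → lookup (B - b) v ≡ true) →
    Consecutive d (add (B - b) y) (add (B - b) w)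
  series-consecutive B b ∣B∣≡d b∈B {y} {w} y<w y∉ w∉ between
    with trues-consecutive (not ∘ lookup (B - b)) y w y<w (cong not y∉) (cong not w∉) (λ v y<v v<w → cong not (between v y<v v<w))
  ... | xs , ys , eq = B , b , ∣B∣≡d , VP.lookup⇒[]= b B b∈B , map (add (B - b)) xs , map (add (B - b)) ys ,
        trans (series≡ B b) (trans (cong (map (add (B - b))) eq) (LP.map-++ (add (B - b)) xs _))

  series-middle : (τ : SignFn n) → IsCoSignotope n d τ → ∀ (B : Subset n) b → IsDSubset d B → lookup B b ≡ true →
    ∀ {y w z} → y F.< w → w F.< z → lookup (B - b) y ≡ false → lookup (B - b) w ≡ false → lookup (B - b) z ≡ false →
    τ (add (B - b) y) ≡ τ (add (B - b) z) → τ (add (B - b) w) ≡ τ (add (B - b) y)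
  series-middle τ τ-cos B b ∣B∣≡d b∈B {y} {w} {z} y<w w<z y∉ w∉ z∉ τy≡τz =
    one-change⇒middle _ _ (≤-trans (changes-mono triple⊑series) (τ-cos B b ∣B∣≡d (VP.lookup⇒[]= b B b∈B)))
    where
    τ′ : Fin n → Sign
    τ′ = τ ∘ add (B - b)
    map-series : map τ (series B b) ≡ map τ′ (trues (not ∘ lookup (B - b)))
    map-series = trans (cong (map τ) (series≡ B b)) (sym (LP.map-∘ _))
    triple⊑series : (τ′ y ∷ τ′ w ∷ τ′ y ∷ []) ⊑ map τ (series B b)
    triple⊑series = subst₂ _⊑_ (cong (λ s → τ′ y ∷ τ′ w ∷ s ∷ []) (sym τy≡τz)) (sym map-series)
      (⊑-map⁺ τ′ ([y,w,z]⊑trues _ y w z y<w w<z (cong not y∉) (cong not w∉) (cong not z∉)))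

  add-series-middle : (τ : SignFn n) → IsCoSignotope n d τ → ∀ (C : Subset n) b → lookup C b ≡ false →
    IsDSubset d (add C b) → ∀ {y w z} → y F.< w → w F.< z →
    lookup C y ≡ false → lookup C w ≡ false → lookup C z ≡ false →
    τ (add C y) ≡ τ (add C z) → τ (add C w) ≡ τ (add C y)
  add-series-middle τ τ-cos C b b∉C ∣B∣≡d y<w w<z y∉ w∉ z∉ τy≡τz
    with series-middle τ τ-cos (add C b) b ∣B∣≡d (lookup-add-same C b)
  ... | middle rewrite minus-add-self C b b∉C = middle y<w w<z y∉ w∉ z∉ τy≡τz

series-length : ∀ {n d} (R : Subset n) e → IsDSubset d R → lookup R e ≡ true →
  count (not ∘ lookup (R - e)) ≡ suc (n ∸ d)
series-length {n} {d} R e ∣R∣≡d e∈R with count (not ∘ lookup (R - e)) in q≡ | count-complement (lookup (R - e))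
... | zero  | c+0≡n = ⊥-elim (<-irrefl refl (begin-strict
  c       <⟨ n<1+n c ⟩
  suc c   ≡⟨ suc-count-minus≡d R e ∣R∣≡d e∈R ⟩
  d       ≤⟨ subst (_≤ n) ∣R∣≡d (DSP.∣p∣≤n R) ⟩
  n       ≡⟨ trans (sym c+0≡n) (+-identityʳ c) ⟩
  c       ∎))
  where
  open ≤-Reasoning
  c : ℕ
  c = count (lookup (R - e))
... | suc q | c+q≡n = cong suc (begin
  q                              ≡⟨ m+n∸m≡n c q ⟨
  c + q ∸ c                      ≡⟨ cong (_∸ suc c) (+-suc c q) ⟨
  c + suc q ∸ suc c              ≡⟨ cong₂ _∸_ c+q≡n (suc-count-minus≡d R e ∣R∣≡d e∈R) ⟩
  n ∸ d                          ∎)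
  where
  open ≡-Reasoning
  c : ℕ
  c = count (lookup (R - e))

module SiblingSeries {n : ℕ} (C : Subset n) (x x′ e : Fin n)
  (x∉C : lookup C x ≡ false) (x′∉C : lookup C x′ ≡ false) (e∈C : lookup C e ≡ true) where

  R S : Subset n
  R = add C x
  S = add C x′

  e∈R : lookup R e ≡ true
  e∈R = lookup-add-inside C x e e∈C

  e∈S : lookup S e ≡ true
  e∈S = lookup-add-inside C x′ e e∈C

  ∉C⇒≢e : ∀ {y} → lookup C y ≡ false → y ≢ e
  ∉C⇒≢e y∉C refl = contradiction (trans (sym e∈C) y∉C) λ ()

  x∈R-e : lookup (R - e) x ≡ true
  x∈R-e = trans (lookup-minus-other R e x (∉C⇒≢e x∉C)) (lookup-add-same C x)

  ∉R-e⇒≢x : ∀ {z} → lookup (R - e) z ≡ false → z ≢ x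
  ∉R-e⇒≢x z∉ refl = contradiction (trans (sym x∈R-e) z∉) λ ()

  ∉R-e⇒∉C : ∀ {z} → lookup (R - e) z ≡ false → z ≢ e → lookup C z ≡ false
  ∉R-e⇒∉C {z} z∉ z≢e = trans (sym (lookup-add-other C x z (∉R-e⇒≢x z∉))) (lookup-minus-outside⁻ R e z z≢e z∉)

  ∉R-e⇒∉S-e : ∀ {z} → lookup (R - e) z ≡ false → z ≢ e → z ≢ x′ → lookup (S - e) z ≡ false
  ∉R-e⇒∉S-e {z} z∉ z≢e z≢x′ =
    trans (lookup-minus-other S e z z≢e) (trans (lookup-add-other C x′ z z≢x′) (∉R-e⇒∉C z∉ z≢e))

  x∉S : x ≢ x′ → lookup S x ≡ false
  x∉S x≢x′ = trans (lookup-add-other C x′ x x≢x′) x∉C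

  below-R≢S : ∀ {z} → lookup (R - e) z ≡ false → x ≢ x′ → exchange R e z ≢ S
  below-R≢S {z} z∉ x≢x′ eq with z FP.≟ e
  ... | yes refl = contradiction (begin
    true                        ≡⟨ lookup-exchange-inside R e z x (∉C⇒≢e x∉C) (lookup-add-same C x) ⟨
    lookup (exchange R e z) x   ≡⟨ cong (λ V → lookup V x) eq ⟩
    lookup S x                  ≡⟨ x∉S x≢x′ ⟩
    false                       ∎) λ ()
    where open ≡-Reasoning
  ... | no z≢e = contradiction (trans (sym e∈S) (trans (cong (λ V → lookup V e) (sym eq)) (lookup-exchange-old R e z z≢e))) λ ()

  exchange-R≡exchange-S⇒≡ : ∀ {z z′} → lookup (R - e) z ≡ false → lookup (R - e) z′ ≡ false →
    exchange R e z ≡ exchange S e z′ → z ≡ z′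
  exchange-R≡exchange-S⇒≡ {z} {z′} z∉ z′∉ eq with x FP.≟ x′
  ... | yes x≡x′ = exchange-injective R e z∉ (trans eq (cong (λ y → exchange (add C y) e z′) (sym x≡x′)))
  ... | no x≢x′  = contradiction (begin
    true                         ≡⟨ lookup-exchange-inside R e z x (∉C⇒≢e x∉C) (lookup-add-same C x) ⟨
    lookup (exchange R e z) x    ≡⟨ cong (λ V → lookup V x) eq ⟩
    lookup (exchange S e z′) x   ≡⟨ lookup-exchange-other S e z′ x (∉R-e⇒≢x z′∉ ∘ sym) (∉C⇒≢e x∉C) ⟩
    lookup S x                   ≡⟨ x∉S x≢x′ ⟩
    false                        ∎) λ ()
    where open ≡-Reasoning

  S≢above-S : ∀ {z′} → e F.< z′ → S ≢ exchange S e z′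
  S≢above-S {z′} e<z′ eq =
    contradiction (trans (sym e∈S) (trans (cong (λ V → lookup V e) eq) (lookup-exchange-old S e z′ (FP.<⇒≢ e<z′ ∘ sym))))
      λ ()

  upper-half lower-half : Fin n → Bool
  upper-half z = (toℕ e ≤ᵇ toℕ z) ∧ not (lookup (R - e) z)
  lower-half z = (toℕ z ≤ᵇ toℕ e) ∧ not (lookup (S - e) z)

  -- The (R,e)-series from R upwards and the (S,e)-series from S downwards: compared with the
  -- series of C - e, the first misses only x and the second only x′, and both contain e.
  halves-count : ∀ {d} → IsDSubset d R → suc (n ∸ d) ≤ count upper-half + count lower-half
  halves-count {d} ∣R∣≡d = +-cancelʳ-≤ 2 _ _ (begin
    suc (n ∸ d) + 2                                    ≡⟨ +-comm 1 (n ∸ d + 2) ⟩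
    n ∸ d + 2 + 1                                      ≡⟨ cong (_+ 1) outside-K ⟨
    count (not ∘ lookup K) + 1                         ≤⟨ +-monoʳ-≤ (count (not ∘ lookup K)) (count≥1 _ e both-at-e) ⟩
    count (not ∘ lookup K) + count (λ z → upper-K z ∧ lower-K z)
        ≡⟨ cong (_+ count (λ z → upper-K z ∧ lower-K z)) (count-cong (λ z → sym (upper-K∨lower-K z))) ⟩
    count (λ z → upper-K z ∨ lower-K z) + count (λ z → upper-K z ∧ lower-K z)
        ≡⟨ count-∨-∧ upper-K lower-K ⟩
    count upper-K + count lower-K
        ≤⟨ +-mono-≤ (count-update-≤ upper-K upper-half x upper-agree upper-at-x)
                    (count-update-≤ lower-K lower-half x′ lower-agree lower-at-x′) ⟩
    (count upper-half + 1) + (count lower-half + 1)    ≡⟨ +-interchange (count upper-half) 1 (count lower-half) 1 ⟩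
    count upper-half + count lower-half + 2            ∎)
    where
    open ≤-Reasoning
    K : Subset n
    K = C - e
    upper-K lower-K : Fin n → Bool
    upper-K z = (toℕ e ≤ᵇ toℕ z) ∧ not (lookup K z)
    lower-K z = (toℕ z ≤ᵇ toℕ e) ∧ not (lookup K z)
    agree : ∀ y → lookup C y ≡ false → ∀ z → z ≢ y → lookup (add C y - e) z ≡ lookup K z
    agree y y∉C z z≢y with z FP.≟ e
    ... | yes refl = trans (lookup-minus-same (add C y) z) (sym (lookup-minus-same C z))
    ... | no z≢e   = trans (lookup-minus-other (add C y) e z z≢e)
                       (trans (lookup-add-other C y z z≢y) (sym (lookup-minus-other C e z z≢e)))
    inside-at : ∀ y → lookup C y ≡ false → lookup (add C y - e) y ≡ true
    inside-at y y∉C = trans (lookup-minus-other (add C y) e y (∉C⇒≢e y∉C)) (lookup-add-same C y)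
    upper-agree : ∀ z → z ≢ x → upper-K z ≡ upper-half z
    upper-agree z z≢x = cong (λ b → (toℕ e ≤ᵇ toℕ z) ∧ not b) (sym (agree x x∉C z z≢x))
    lower-agree : ∀ z → z ≢ x′ → lower-K z ≡ lower-half z
    lower-agree z z≢x′ = cong (λ b → (toℕ z ≤ᵇ toℕ e) ∧ not b) (sym (agree x′ x′∉C z z≢x′))
    upper-at-x : upper-half x ≡ false
    upper-at-x rewrite inside-at x x∉C = ∧-zeroʳ _
    lower-at-x′ : lower-half x′ ≡ false
    lower-at-x′ rewrite inside-at x′ x′∉C = ∧-zeroʳ _
    upper-K∨lower-K : ∀ z → upper-K z ∨ lower-K z ≡ not (lookup K z)
    upper-K∨lower-K z rewrite sym (∧-distribʳ-∨ (not (lookup K z)) (toℕ e ≤ᵇ toℕ z) (toℕ z ≤ᵇ toℕ e))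
                            | ≤ᵇ-total (toℕ e) (toℕ z) = refl
    both-at-e : upper-K e ∧ lower-K e ≡ true
    both-at-e rewrite ≤ᵇ-true (≤-refl {toℕ e}) | lookup-minus-same C e = refl
    d≡ : 2 + count (lookup K) ≡ d
    d≡ = trans (cong suc (count-minus C e e∈C)) (trans (sym (count-add C x x∉C)) (trans (sym (∣∣≡count R)) ∣R∣≡d))
    outside-K : count (not ∘ lookup K) ≡ n ∸ d + 2
    outside-K = +-cancelʳ-≡ (count (lookup K)) _ _ (begin-equality
      count (not ∘ lookup K) + count (lookup K)      ≡⟨ +-comm _ (count (lookup K)) ⟩
      count (lookup K) + count (not ∘ lookup K)      ≡⟨ count-complement (lookup K) ⟩
      n                                              ≡⟨ m∸n+n≡m (subst (_≤ n) ∣R∣≡d (DSP.∣p∣≤n R)) ⟨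
      n ∸ d + d                                      ≡⟨ cong (n ∸ d +_) d≡ ⟨
      n ∸ d + (2 + count (lookup K))                 ≡⟨ +-assoc (n ∸ d) 2 _ ⟨
      n ∸ d + 2 + count (lookup K)                   ∎)

-- The sets S_{n,d,i}

module _ {n : ℕ} (d : ℕ) where

  lookup-Sndi : ∀ i (v : Fin n) → lookup (Sndi n d i) v ≡ (toℕ v <ᵇ i) ∨ (n ∸ d + i ≤ᵇ toℕ v)
  lookup-Sndi i v = VP.lookup∘tabulate _ v

  lookup-Sndi-low : ∀ {i} (v : Fin n) → toℕ v < i → lookup (Sndi n d i) v ≡ true
  lookup-Sndi-low {i} v v<i rewrite lookup-Sndi i v with toℕ v <ᵇ i | <ᵇ-reflects-< (toℕ v) i
  ... | true  | _        = refl
  ... | false | ofⁿ v≮i = ⊥-elim (v≮i v<i)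

  lookup-Sndi-high : ∀ {i} (v : Fin n) → n ∸ d + i ≤ toℕ v → lookup (Sndi n d i) v ≡ true
  lookup-Sndi-high {i} v high rewrite lookup-Sndi i v with n ∸ d + i ≤ᵇ toℕ v | ≤ᵇ-reflects-≤ (n ∸ d + i) (toℕ v)
  ... | true  | _         = ∨-zeroʳ _
  ... | false | ofⁿ ¬high = ⊥-elim (¬high high)

  lookup-Sndi-mid : ∀ {i} (v : Fin n) → i ≤ toℕ v → toℕ v < n ∸ d + i → lookup (Sndi n d i) v ≡ false
  lookup-Sndi-mid {i} v i≤v v<n∸d+i rewrite lookup-Sndi i v
    with toℕ v <ᵇ i | <ᵇ-reflects-< (toℕ v) i | n ∸ d + i ≤ᵇ toℕ v | ≤ᵇ-reflects-≤ (n ∸ d + i) (toℕ v)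
  ... | false | _        | false | _         = refl
  ... | true  | ofʸ v<i  | _     | _         = ⊥-elim (<⇒≱ v<i i≤v)
  ... | false | _        | true  | ofʸ high  = ⊥-elim (<⇒≱ v<n∸d+i high)

  Sndi-inside-high : ∀ {i} (v : Fin n) → lookup (Sndi n d i) v ≡ true → i ≤ toℕ v → n ∸ d + i ≤ toℕ v
  Sndi-inside-high v v∈S i≤v = ≮⇒≥ λ v<n∸d+i → contradiction (trans (sym v∈S) (lookup-Sndi-mid v i≤v v<n∸d+i)) λ ()

  lookup-Sndi-suc : ∀ {i} (w : Fin n) → toℕ w ≢ i → toℕ w ≢ n ∸ d + i →
    lookup (Sndi n d i) w ≡ lookup (Sndi n d (suc i)) w
  lookup-Sndi-suc {i} w w≢i w≢top = begin
    lookup (Sndi n d i) w                            ≡⟨ lookup-Sndi i w ⟩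
    (toℕ w <ᵇ i) ∨ (n ∸ d + i ≤ᵇ toℕ w)
      ≡⟨ cong₂ _∨_ (<ᵇ-suc (toℕ w) i w≢i) (≤ᵇ-suc (n ∸ d + i) (toℕ w) (w≢top ∘ sym)) ⟩
    (toℕ w <ᵇ suc i) ∨ (suc (n ∸ d + i) ≤ᵇ toℕ w)
      ≡⟨ cong (λ k → (toℕ w <ᵇ suc i) ∨ (k ≤ᵇ toℕ w)) (+-suc (n ∸ d) i) ⟨
    (toℕ w <ᵇ suc i) ∨ (n ∸ d + suc i ≤ᵇ toℕ w)      ≡⟨ lookup-Sndi (suc i) w ⟨
    lookup (Sndi n d (suc i)) w                      ∎
    where open ≡-Reasoning

  -- S_{n,d,i+1} arises from S_{n,d,i} by exchanging its element n - d + i for i (0-based).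
  Sndi-siblings : ∀ {i} → suc i ≤ d → d < n → Siblings (Sndi n d i) (Sndi n d (suc i))
  Sndi-siblings {i} i<d d<n = subst₂ Siblings (add-minus-self S v v∈S) (subset-ext add-u≗S′)
    (siblings (S - v) v u (lookup-minus-same S v) (lookup-minus-outside S v u u∉S))
    where
    S : Subset n
    S = Sndi n d i
    v<n : n ∸ d + i < n
    v<n = subst (n ∸ d + i <_) (m∸n+n≡m (<⇒≤ d<n)) (+-monoʳ-< (n ∸ d) i<d)
    i<n∸d+i : i < n ∸ d + i
    i<n∸d+i = +-monoˡ-≤ i (m<n⇒0<n∸m d<n)
    v u : Fin n
    v = fromℕ< v<n
    u = fromℕ< (<-trans i<n∸d+i v<n)
    toℕ-v : toℕ v ≡ n ∸ d + i
    toℕ-v = FP.toℕ-fromℕ< v<n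
    toℕ-u : toℕ u ≡ i
    toℕ-u = FP.toℕ-fromℕ< _
    v∈S : lookup S v ≡ true
    v∈S = lookup-Sndi-high v (≤-reflexive (sym toℕ-v))
    u∉S : lookup S u ≡ false
    u∉S = lookup-Sndi-mid u (≤-reflexive (sym toℕ-u)) (subst (_< n ∸ d + i) (sym toℕ-u) i<n∸d+i)
    add-u≗S′ : ∀ w → lookup (add (S - v) u) w ≡ lookup (Sndi n d (suc i)) w
    add-u≗S′ w with w FP.≟ u | w FP.≟ v
    ... | yes refl | _ = trans (lookup-add-same (S - v) w) (sym (lookup-Sndi-low w (s≤s (≤-reflexive toℕ-u))))
    ... | no w≢u | yes refl = trans (lookup-add-other (S - v) u w w≢u) (trans (lookup-minus-same S w)
          (sym (lookup-Sndi-mid w (subst (suc i ≤_) (sym toℕ-v) i<n∸d+i)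
                 (subst (_< n ∸ d + suc i) (sym toℕ-v) (≤-reflexive (sym (+-suc (n ∸ d) i)))))))
    ... | no w≢u | no w≢v = trans (lookup-add-other (S - v) u w w≢u) (trans (lookup-minus-other S v w w≢v)
          (lookup-Sndi-suc w (λ w≡i → w≢u (FP.toℕ-injective (trans w≡i (sym toℕ-u))))
                             (λ w≡top → w≢v (FP.toℕ-injective (trans w≡top (sym toℕ-v))))))

-- Co-signotopes with at most n - d +-subsets

module SmallCoSignotope {n d a : ℕ} (τ : SignFn n) (τ-cos : IsCoSignotope n d τ)
  (plus-size : HasSize (Plus d τ) a) (a≤n∸d : a ≤ n ∸ d) where

  plus-family≤a : (P : Fin n → Bool) (h : Fin n → Subset n) → (∀ z → P z ≡ true → Plus d τ (h z)) →
    (∀ z z′ → P z ≡ true → P z′ ≡ true → h z ≡ h z′ → z ≡ z′) → count P ≤ a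
  plus-family≤a P h plus inj =
    let (L , _ , length≡a , ∈L⇔) = plus-size
    in subst (count P ≤_) length≡a (count≤length P h L (λ z Pz → Equivalence.from (∈L⇔ (h z)) (plus z Pz)) inj)

  -- A series has n - d + 1 entries, one more than there are +-subsets.
  no-plus-family-on-series : ∀ (R : Subset n) e → IsDSubset d R → lookup R e ≡ true → (h : Fin n → Subset n) →
    (∀ z → lookup (R - e) z ≡ false → Plus d τ (h z)) →
    (∀ z z′ → lookup (R - e) z ≡ false → lookup (R - e) z′ ≡ false → h z ≡ h z′ → z ≡ z′) → ⊥
  no-plus-family-on-series R e ∣R∣≡d e∈R h plus inj = <-irrefl refl (begin-strict
    n ∸ d                           <⟨ n<1+n _ ⟩
    suc (n ∸ d)                     ≡⟨ series-length R e ∣R∣≡d e∈R ⟨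
    count (not ∘ lookup (R - e))    ≤⟨ plus-family≤a _ h (λ z z∉ → plus z (not≡true z∉))
                                          (λ z z′ z∉ z′∉ → inj z z′ (not≡true z∉) (not≡true z′∉)) ⟩
    a                               ≤⟨ a≤n∸d ⟩
    n ∸ d                           ∎)
    where
    open ≤-Reasoning

  exchange-plus : ∀ {R e z} → Plus d τ R → lookup R e ≡ true → lookup (R - e) z ≡ false →
    τ (exchange R e z) ≡ ⊕ → Plus d τ (exchange R e z)
  exchange-plus {R} {e} {z} (∣R∣≡d , _) e∈R z∉ τz = ∣exchange∣ R e z ∣R∣≡d e∈R z∉ , τz

  exchange-self-plus : ∀ {R e} → Plus d τ R → lookup R e ≡ true → Plus d τ (exchange R e e)
  exchange-self-plus {R} {e} R-plus e∈R = subst (Plus d τ) (sym (add-minus-self R e e∈R)) R-plus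

  Down Up : Subset n → Fin n → Set
  Down R e = ∀ y → y F.< e → lookup R y ≡ false → τ (exchange R e y) ≡ ⊕
  Up   R e = ∀ z → e F.< z → lookup R z ≡ false → τ (exchange R e z) ≡ ⊕

  down-at? : ∀ R e y → Dec (y F.< e → lookup R y ≡ false → τ (exchange R e y) ≡ ⊕)
  down-at? R e y = y F.<? e →-dec (lookup R y Bool.≟ false →-dec τ (exchange R e y) ≟ˢ ⊕)

  down? : ∀ R e → Dec (Down R e)
  down? R e = FP.all? (down-at? R e)

  ¬Down⇒witness : ∀ {R e} → ¬ Down R e → ∃ λ y → y F.< e × lookup R y ≡ false × τ (exchange R e y) ≡ ⊖
  ¬Down⇒witness {R} {e} ¬down with FP.¬∀⟶∃¬ n _ (down-at? R e) ¬down
  ... | y , ¬down-at with y F.<? e | lookup R y in y∈? | τ (exchange R e y) in τy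
  ...   | no y≮e  | _     | _ = ⊥-elim (¬down-at (λ y<e → ⊥-elim (y≮e y<e)))
  ...   | yes _   | true  | _ = ⊥-elim (¬down-at (λ _ ()))
  ...   | yes _   | false | ⊕ = ⊥-elim (¬down-at (λ _ _ → refl))
  ...   | yes y<e | false | ⊖ = y , y<e , y∈? , τy

  Down∧Up⇒⊥ : ∀ {R e} → Plus d τ R → lookup R e ≡ true → Down R e → Up R e → ⊥
  Down∧Up⇒⊥ {R} {e} R-plus e∈R down up =
    no-plus-family-on-series R e (proj₁ R-plus) e∈R (exchange R e) plus (λ z z′ z∉ _ → exchange-injective R e z∉)
    where
    plus : ∀ z → lookup (R - e) z ≡ false → Plus d τ (exchange R e z)
    plus z z∉ with FP.<-cmp z e
    ... | tri< z<e _ _ = exchange-plus R-plus e∈R z∉ (down z z<e (lookup-minus-outside⁻ R e z (FP.<⇒≢ z<e) z∉))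
    ... | tri≈ _ refl _ = exchange-self-plus R-plus e∈R
    ... | tri> _ _ e<z = exchange-plus R-plus e∈R z∉ (up z e<z (lookup-minus-outside⁻ R e z (FP.<⇒≢ e<z ∘ sym) z∉))

  -- A − entry below e and a − entry above e would surround the + entry R with two sign changes.
  ¬Down⇒Up : ∀ {R e} → Plus d τ R → lookup R e ≡ true → ¬ Down R e → Up R e
  ¬Down⇒Up {R} {e} (∣R∣≡d , τR) e∈R ¬down z e<z z∉R with ¬Down⇒witness ¬down | τ (exchange R e z) in τz
  ... | _ | ⊕ = refl
  ... | y , y<e , y∉R , τy | ⊖ = contradiction (begin
    ⊕                       ≡⟨ τR ⟨
    τ R                     ≡⟨ cong τ (add-minus-self R e e∈R) ⟨
    τ (exchange R e e)      ≡⟨ series-middle τ τ-cos R e ∣R∣≡d e∈R y<e e<z (lookup-minus-outside R e y y∉R)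
                                 (lookup-minus-same R e) (lookup-minus-outside R e z z∉R) (trans τy (sym τz)) ⟩
    τ (exchange R e y)      ≡⟨ τy ⟩
    ⊖                       ∎) λ ()
    where open ≡-Reasoning

  -- Otherwise the upper half of the (R,e₁)-series and the lower half of the (R,e₂)-series
  -- would give n - d + 1 distinct +-subsets.
  Down-downward : ∀ {R e₁ e₂} → Plus d τ R → lookup R e₁ ≡ true → lookup R e₂ ≡ true → e₁ F.< e₂ →
    Down R e₂ → Down R e₁
  Down-downward {R} {e₁} {e₂} R-plus e₁∈R e₂∈R e₁<e₂ down₂ = decidable-stable (down? R e₁) λ ¬down₁ →
    no-plus-family-on-series R e₁ (proj₁ R-plus) e₁∈R h (plus (¬Down⇒Up R-plus e₁∈R ¬down₁)) inj
    where
    h : Fin n → Subset n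
    h z with z F.<? e₁
    ... | yes _ = exchange R e₂ z
    ... | no _  = exchange R e₁ z
    plus : Up R e₁ → ∀ z → lookup (R - e₁) z ≡ false → Plus d τ (h z)
    plus up₁ z z∉ with z F.<? e₁
    ... | yes z<e₁ = exchange-plus R-plus e₂∈R (lookup-minus-outside R e₂ z z∉R) (down₂ z (<-trans z<e₁ e₁<e₂) z∉R)
      where
      z∉R : lookup R z ≡ false
      z∉R = lookup-minus-outside⁻ R e₁ z (FP.<⇒≢ z<e₁) z∉
    ... | no z≮e₁ with z FP.≟ e₁
    ...   | yes refl = exchange-self-plus R-plus e₁∈R
    ...   | no z≢e₁  = exchange-plus R-plus e₁∈R z∉ (up₁ z e₁<z (lookup-minus-outside⁻ R e₁ z z≢e₁ z∉))
      where
      e₁<z : e₁ F.< z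
      e₁<z = FP.≤∧≢⇒< (≮⇒≥ z≮e₁) (z≢e₁ ∘ sym)
    apart : ∀ z z′ → z′ F.< e₁ → exchange R e₁ z ≢ exchange R e₂ z′
    apart z z′ z′<e₁ eq = contradiction (begin
      true                          ≡⟨ lookup-exchange-inside R e₁ z e₂ (FP.<⇒≢ e₁<e₂ ∘ sym) e₂∈R ⟨
      lookup (exchange R e₁ z) e₂   ≡⟨ cong (λ V → lookup V e₂) eq ⟩
      lookup (exchange R e₂ z′) e₂  ≡⟨ lookup-exchange-old R e₂ z′ (FP.<⇒≢ (<-trans z′<e₁ e₁<e₂)) ⟩
      false                         ∎) λ ()
      where open ≡-Reasoning
    inj : ∀ z z′ → lookup (R - e₁) z ≡ false → lookup (R - e₁) z′ ≡ false → h z ≡ h z′ → z ≡ z′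
    inj z z′ z∉ z′∉ eq with z F.<? e₁ | z′ F.<? e₁
    ... | no _     | no _      = exchange-injective R e₁ z∉ eq
    ... | no _     | yes z′<e₁ = ⊥-elim (apart z z′ z′<e₁ eq)
    ... | yes z<e₁ | no _      = ⊥-elim (apart z′ z z<e₁ (sym eq))
    ... | yes z<e₁ | yes _     = exchange-injective R e₂
      (lookup-minus-outside R e₂ z (lookup-minus-outside⁻ R e₁ z (FP.<⇒≢ z<e₁) z∉)) eq

  -- Otherwise the (R,e)-series up to R and the (S,e)-series beyond S, with S itself standing
  -- in for the entry at x′, would give n - d + 1 distinct +-subsets.
  Down-siblings : ∀ C x x′ → lookup C x ≡ false → lookup C x′ ≡ false → Plus d τ (add C x) → Plus d τ (add C x′) →
    ∀ e → lookup C e ≡ true → Down (add C x) e → Down (add C x′) e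
  Down-siblings C x x′ x∉C x′∉C R-plus S-plus e e∈C downR = decidable-stable (down? S e) λ ¬downS →
    no-plus-family-on-series R e (proj₁ R-plus) e∈R h (plus (¬Down⇒Up S-plus e∈S ¬downS)) inj
    where
    open SiblingSeries C x x′ e x∉C x′∉C e∈C
    h : Fin n → Subset n
    h z with e F.<? z | z FP.≟ x′
    ... | no _  | _     = exchange R e z
    ... | yes _ | yes _ = S
    ... | yes _ | no _  = exchange S e z
    plus : Up S e → ∀ z → lookup (R - e) z ≡ false → Plus d τ (h z)
    plus upS z z∉ with e F.<? z | z FP.≟ x′
    ... | yes _   | yes _   = S-plus
    ... | yes e<z | no z≢x′ = exchange-plus S-plus e∈S (∉R-e⇒∉S-e z∉ z≢e z≢x′)
                                (upS z e<z (trans (lookup-add-other C x′ z z≢x′) (∉R-e⇒∉C z∉ z≢e)))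
      where
      z≢e : z ≢ e
      z≢e = FP.<⇒≢ e<z ∘ sym
    ... | no e≮z | _ with z FP.≟ e
    ...   | yes refl = exchange-self-plus R-plus e∈R
    ...   | no z≢e   = exchange-plus R-plus e∈R z∉
                           (downR z (FP.≤∧≢⇒< (≮⇒≥ e≮z) z≢e) (lookup-minus-outside⁻ R e z z≢e z∉))
    inj : ∀ z z′ → lookup (R - e) z ≡ false → lookup (R - e) z′ ≡ false → h z ≡ h z′ → z ≡ z′
    inj z z′ z∉ z′∉ eq with e F.<? z | z FP.≟ x′ | e F.<? z′ | z′ FP.≟ x′
    ... | no _    | _         | no _     | _         = exchange-injective R e z∉ eq
    ... | no _    | _         | yes _    | yes refl  = ⊥-elim (below-R≢S z∉ (∉R-e⇒≢x z′∉ ∘ sym) eq)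
    ... | no _    | _         | yes _    | no _      = exchange-R≡exchange-S⇒≡ z∉ z′∉ eq
    ... | yes _   | yes refl  | no _     | _         = ⊥-elim (below-R≢S z′∉ (∉R-e⇒≢x z∉ ∘ sym) (sym eq))
    ... | yes _   | no _      | no _     | _         = sym (exchange-R≡exchange-S⇒≡ z′∉ z∉ (sym eq))
    ... | yes _   | yes z≡x′  | yes _    | yes z′≡x′ = trans z≡x′ (sym z′≡x′)
    ... | yes _   | yes _     | yes e<z′ | no _      = ⊥-elim (S≢above-S e<z′ eq)
    ... | yes e<z | no _      | yes _    | yes _     = ⊥-elim (S≢above-S e<z (sym eq))
    ... | yes e<z | no z≢x′   | yes _    | no _      =
      exchange-injective S e (∉R-e⇒∉S-e z∉ (FP.<⇒≢ e<z ∘ sym) z≢x′) eq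

  -- The series of C through R and S: R and S are + and so is everything between them.
  Down-moved : ∀ C x x′ → lookup C x ≡ false → lookup C x′ ≡ false → Plus d τ (add C x) → Plus d τ (add C x′) →
    Down (add C x) x → Down (add C x′) x′
  Down-moved C x x′ x∉C x′∉C R-plus S-plus downR y y<x′ y∉S =
    subst (λ V → τ (add V y) ≡ ⊕) (sym (minus-add-self C x′ x′∉C)) (add-y-plus (FP.<-cmp y x))
    where
    y∉C : lookup C y ≡ false
    y∉C = trans (sym (lookup-add-other C x′ y (FP.<⇒≢ y<x′))) y∉S
    add-y-plus : Tri (y F.< x) (y ≡ x) (x F.< y) → τ (add C y) ≡ ⊕
    add-y-plus (tri< y<x _ _) = subst (λ V → τ (add V y) ≡ ⊕) (minus-add-self C x x∉C)
                                  (downR y y<x (trans (lookup-add-other C x y (FP.<⇒≢ y<x)) y∉C))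
    add-y-plus (tri≈ _ refl _) = proj₂ R-plus
    add-y-plus (tri> _ _ x<y) = trans (add-series-middle τ τ-cos C x x∉C (proj₁ R-plus) x<y y<x′ x∉C y∉C x′∉C
                                        (trans (proj₂ R-plus) (sym (proj₂ S-plus)))) (proj₂ R-plus)

  down : Subset n → Fin n → Bool
  down R e = does (down? R e)

  down⇒Down : ∀ {R e} → down R e ≡ true → Down R e
  down⇒Down {R} {e} = does≡true⇒ (down? R e)

  ¬down⇒¬Down : ∀ {R e} → not (down R e) ≡ true → ¬ Down R e
  ¬down⇒¬Down {R} {e} = not-does≡true⇒¬ (down? R e)

  ι-within : Subset n → Subset n → ℕ
  ι-within C R = count (λ e → lookup C e ∧ down R e)

  -- The invariant that separates the +-components C_i.
  ι : Subset n → ℕ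
  ι R = ι-within R R

  -- Each e ∈ R contributes its distance to the end of [n] towards which its series is +;
  -- a walk step moves e in that direction.
  weight : Bool → Fin n → ℕ
  weight true  e = toℕ e
  weight false e = n ∸ suc (toℕ e)

  Φ-within : Subset n → Subset n → ℕ
  Φ-within C R = ∑ (λ e → if lookup C e then weight (down R e) e else 0)

  Φ : Subset n → ℕ
  Φ R = Φ-within R R

  module _ (C : Subset n) (x x′ : Fin n) (x∉C : lookup C x ≡ false) (x′∉C : lookup C x′ ≡ false)
           (R-plus : Plus d τ (add C x)) (S-plus : Plus d τ (add C x′)) where

    down-moved : down (add C x) x ≡ down (add C x′) x′
    down-moved = does-⇔ (mk⇔ (Down-moved C x x′ x∉C x′∉C R-plus S-plus) (Down-moved C x′ x x′∉C x∉C S-plus R-plus))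
      (down? (add C x) x) (down? (add C x′) x′)

    down-common : ∀ e → lookup C e ≡ true → down (add C x) e ≡ down (add C x′) e
    down-common e e∈C = does-⇔ (mk⇔ (Down-siblings C x x′ x∉C x′∉C R-plus S-plus e e∈C)
      (Down-siblings C x′ x x′∉C x∉C S-plus R-plus e e∈C)) (down? (add C x) e) (down? (add C x′) e)

    ι-within-siblings : ι-within C (add C x) ≡ ι-within C (add C x′)
    ι-within-siblings = count-cong common
      where
      common : ∀ e → (lookup C e ∧ down (add C x) e) ≡ (lookup C e ∧ down (add C x′) e)
      common e with lookup C e in e∈C
      ... | false = refl
      ... | true  = down-common e e∈C

    Φ-within-siblings : Φ-within C (add C x) ≡ Φ-within C (add C x′)
    Φ-within-siblings = ∑-cong common
      where
      common : ∀ e → (if lookup C e then weight (down (add C x) e) e else 0)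
                   ≡ (if lookup C e then weight (down (add C x′) e) e else 0)
      common e with lookup C e in e∈C
      ... | false = refl
      ... | true  = cong (λ b → weight b e) (down-common e e∈C)

  ι≤d : ∀ {R} → Plus d τ R → ι R ≤ d
  ι≤d {R} (∣R∣≡d , _) =
    ≤-trans (count-mono (λ e eq → proj₁ (∧-≡-true {lookup R e} eq))) (≤-reflexive (trans (sym (∣∣≡count R)) ∣R∣≡d))

  ι-add : ∀ C x → lookup C x ≡ false → ι (add C x) ≡ ι-within C (add C x) + bit (down (add C x) x)
  ι-add C x x∉C = count-∧-add C x x∉C (down (add C x))

  ι-Siblings : ∀ {R S} → Siblings R S → Plus d τ R → Plus d τ S → ι R ≡ ι S
  ι-Siblings (siblings C x x′ x∉C x′∉C) R-plus S-plus = begin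
    ι (add C x)                                                   ≡⟨ ι-add C x x∉C ⟩
    ι-within C (add C x) + bit (down (add C x) x)
      ≡⟨ cong₂ _+_ (ι-within-siblings C x x′ x∉C x′∉C R-plus S-plus) (cong bit (down-moved C x x′ x∉C x′∉C R-plus S-plus)) ⟩
    ι-within C (add C x′) + bit (down (add C x′) x′)              ≡⟨ ι-add C x′ x′∉C ⟨
    ι (add C x′)                                                  ∎
    where open ≡-Reasoning

  Reach-plus : ∀ {S R} → Reach d τ S R → Plus d τ R
  Reach-plus (here R-plus)       = R-plus
  Reach-plus (step _ _ R-plus)   = R-plus

  Reach-source-plus : ∀ {S R} → Reach d τ S R → Plus d τ S
  Reach-source-plus (here S-plus)  = S-plus
  Reach-source-plus (step r _ _)   = Reach-source-plus r

  ι-Reach : ∀ {S R} → Reach d τ S R → ι R ≡ ι S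
  ι-Reach (here _)                   = refl
  ι-Reach (step r R~R′ R′-plus)      = trans (sym (ι-Siblings (Adjacent⇒Siblings R~R′) (Reach-plus r) R′-plus)) (ι-Reach r)

  ι-Sndi : ∀ {i} → i ≤ d → d < n → Plus d τ (Sndi n d i) → ι (Sndi n d i) ≡ i
  ι-Sndi {i} i≤d d<n S-plus = trans (count-cong pointwise) (count-below i (≤-trans i≤d (<⇒≤ d<n)))
    where
    S : Subset n
    S = Sndi n d i
    low-Down : ∀ v → toℕ v < i → Down S v
    low-Down v v<i y y<v y∉S = contradiction (trans (sym (lookup-Sndi-low d y (<-trans y<v v<i))) y∉S) λ ()
    high-Up : ∀ v → n ∸ d + i ≤ toℕ v → Up S v
    high-Up v high z v<z z∉S = contradiction (trans (sym (lookup-Sndi-high d z (≤-trans high (<⇒≤ v<z)))) z∉S) λ ()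
    pointwise : ∀ v → (lookup S v ∧ down S v) ≡ (toℕ v <ᵇ i)
    pointwise v with toℕ v <ᵇ i | <ᵇ-reflects-< (toℕ v) i
    ... | true  | ofʸ v<i rewrite lookup-Sndi-low d v v<i = dec-true (down? S v) (low-Down v v<i)
    ... | false | ofⁿ v≮i with lookup S v in v∈S
    ...   | false = refl
    ...   | true  = dec-false (down? S v) λ down →
                      Down∧Up⇒⊥ S-plus v∈S down (high-Up v (Sndi-inside-high d v v∈S (≮⇒≥ v≮i)))

  not-both-Sndi : ∀ {i} → suc i ≤ d → d < n → Plus d τ (Sndi n d i) → Plus d τ (Sndi n d (suc i)) → ⊥
  not-both-Sndi {i} i<d d<n S-plus S′-plus = 1+n≢n (begin
    suc i                      ≡⟨ ι-Sndi i<d d<n S′-plus ⟨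
    ι (Sndi n d (suc i))       ≡⟨ ι-Siblings (Sndi-siblings d i<d d<n) S-plus S′-plus ⟨
    ι (Sndi n d i)             ≡⟨ ι-Sndi (<⇒≤ i<d) d<n S-plus ⟩
    i                          ∎)
    where open ≡-Reasoning

  Φ-add : ∀ C x → lookup C x ≡ false → Φ (add C x) ≡ Φ-within C (add C x) + weight (down (add C x) x) x
  Φ-add C x x∉C = ∑-over-add C x x∉C (λ e → weight (down (add C x) e) e)

  Φ-exchange : ∀ C x x′ → lookup C x ≡ false → lookup C x′ ≡ false → Plus d τ (add C x) → Plus d τ (add C x′) →
    weight (down (add C x) x) x′ < weight (down (add C x) x) x → Φ (add C x′) < Φ (add C x)
  Φ-exchange C x x′ x∉C x′∉C R-plus S-plus lighter = begin-strict
    Φ (add C x′)                                         ≡⟨ Φ-add C x′ x′∉C ⟩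
    Φ-within C (add C x′) + weight (down (add C x′) x′) x′
      ≡⟨ cong₂ _+_ (Φ-within-siblings C x x′ x∉C x′∉C R-plus S-plus)
                   (cong (λ b → weight b x′) (down-moved C x x′ x∉C x′∉C R-plus S-plus)) ⟨
    Φ-within C (add C x) + weight (down (add C x) x) x′     <⟨ +-monoʳ-< _ lighter ⟩
    Φ-within C (add C x) + weight (down (add C x) x) x      ≡⟨ Φ-add C x x∉C ⟨
    Φ (add C x)                                           ∎
    where open ≤-Reasoning

  record Move (R : Subset n) : Set where
    field
      next        : Subset n
      next-plus   : Plus d τ next
      next~R      : Adjacent d next R
      Φ-decreases : Φ next < Φ R

  module _ {R e} (R-plus : Plus d τ R) (e∈R : lookup R e ≡ true) where

    private
      R≡add : add (R - e) e ≡ R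
      R≡add = add-minus-self R e e∈R

      add-plus : Plus d τ (add (R - e) e)
      add-plus = exchange-self-plus R-plus e∈R

    move-down : Down R e → ∀ {y} → y F.< e → lookup R y ≡ false → Move R
    move-down downR y<e y∉R with nearest-outside-below R y<e y∉R
    ... | y* , y*<e , y*∉R , between = record
      { next        = exchange R e y*
      ; next-plus   = next-plus
      ; next~R      = inj₁ (subst (Consecutive d (exchange R e y*)) R≡add
                        (series-consecutive R e (proj₁ R-plus) e∈R y*<e y*∉C (lookup-minus-same R e) between-C))
      ; Φ-decreases = subst (λ V → Φ (exchange R e y*) < Φ V) R≡add
                        (Φ-exchange (R - e) e y* (lookup-minus-same R e) y*∉C add-plus next-plus lighter)
      }
      where
      y*∉C : lookup (R - e) y* ≡ false
      y*∉C = lookup-minus-outside R e y* y*∉R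
      next-plus : Plus d τ (exchange R e y*)
      next-plus = exchange-plus R-plus e∈R y*∉C (downR y* y*<e y*∉R)
      between-C : ∀ v → y* F.< v → v F.< e → lookup (R - e) v ≡ true
      between-C v y*<v v<e = trans (lookup-minus-other R e v (FP.<⇒≢ v<e)) (between v y*<v v<e)
      lighter : weight (down (add (R - e) e) e) y* < weight (down (add (R - e) e) e) e
      lighter rewrite R≡add | dec-true (down? R e) downR = y*<e

    move-up : ¬ Down R e → ∀ {z} → e F.< z → lookup R z ≡ false → Move R
    move-up ¬downR e<z z∉R with nearest-outside-above R e<z z∉R
    ... | z* , e<z* , z*∉R , between = record
      { next        = exchange R e z*
      ; next-plus   = next-plus
      ; next~R      = inj₂ (subst (λ V → Consecutive d V (exchange R e z*)) R≡add
                        (series-consecutive R e (proj₁ R-plus) e∈R e<z* (lookup-minus-same R e) z*∉C between-C))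
      ; Φ-decreases = subst (λ V → Φ (exchange R e z*) < Φ V) R≡add
                        (Φ-exchange (R - e) e z* (lookup-minus-same R e) z*∉C add-plus next-plus lighter)
      }
      where
      z*∉C : lookup (R - e) z* ≡ false
      z*∉C = lookup-minus-outside R e z* z*∉R
      next-plus : Plus d τ (exchange R e z*)
      next-plus = exchange-plus R-plus e∈R z*∉C (¬Down⇒Up R-plus e∈R ¬downR z* e<z* z*∉R)
      between-C : ∀ v → e F.< v → v F.< z* → lookup (R - e) v ≡ true
      between-C v e<v v<z* = trans (lookup-minus-other R e v (FP.<⇒≢ e<v ∘ sym)) (between v e<v v<z*)
      lighter : weight (down (add (R - e) e) e) z* < weight (down (add (R - e) e) e) e
      lighter rewrite R≡add | dec-false (down? R e) ¬downR = ∸-monoʳ-< (s≤s e<z*) (FP.toℕ<n z*)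

  DownClosed UpClosed : Subset n → Set
  DownClosed R = ∀ e y → lookup R e ≡ true → Down R e → y F.< e → lookup R y ≡ true
  UpClosed   R = ∀ e z → lookup R e ≡ true → ¬ Down R e → e F.< z → lookup R z ≡ true

  -- A +-subset from which no walk step starts is S_{n,d,ι R}: its Down elements form an initial
  -- segment of [n] and its Up elements a final one.
  module Terminal {R} (R-plus : Plus d τ R) (down-closed : DownClosed R) (up-closed : UpClosed R) where

    U : ℕ
    U = count (λ w → lookup R w ∧ not (down R w))

    ι+U≡d : ι R + U ≡ d
    ι+U≡d = trans (count-∧-split (lookup R) (down R)) (trans (sym (∣∣≡count R)) (proj₁ R-plus))

    d≤n : d ≤ n
    d≤n = subst (_≤ n) (proj₁ R-plus) (DSP.∣p∣≤n R)

    low-inside : ∀ v → toℕ v < ι R → lookup R v ≡ true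
    low-inside v v<ι with lookup R v in v∈R?
    ... | true  = refl
    ... | false = ⊥-elim (<-irrefl refl
      (≤-trans v<ι (≤-trans (count-mono below-v) (≤-reflexive (count-below (toℕ v) (<⇒≤ (FP.toℕ<n v)))))))
      where
      below-v : ∀ u → lookup R u ∧ down R u ≡ true → (toℕ u <ᵇ toℕ v) ≡ true
      below-v u eq with ∧-≡-true eq | FP.<-cmp u v
      ... | _ | tri< u<v _ _ = <ᵇ-true u<v
      ... | (u∈R , _) | tri≈ _ refl _ = contradiction (trans (sym u∈R) v∈R?) λ ()
      ... | (u∈R , downU) | tri> _ _ v<u = contradiction (trans (sym (down-closed u v u∈R (down⇒Down downU) v<u)) v∈R?) λ ()

    high-inside : ∀ v → n ∸ d + ι R ≤ toℕ v → lookup R v ≡ true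
    high-inside v high with lookup R v in v∈R?
    ... | true  = refl
    ... | false = ⊥-elim (<-irrefl refl (begin-strict
      n                                  ≡⟨ m∸n+n≡m d≤n ⟨
      n ∸ d + d                          ≡⟨ cong (n ∸ d +_) ι+U≡d ⟨
      n ∸ d + (ι R + U)                  ≡⟨ +-assoc (n ∸ d) (ι R) U ⟨
      n ∸ d + ι R + U                    ≤⟨ +-monoˡ-≤ U high ⟩
      toℕ v + U                          <⟨ +-monoʳ-≤ (suc (toℕ v)) U≤ ⟩
      suc (toℕ v) + (n ∸ suc (toℕ v))    ≡⟨ m+[n∸m]≡n (FP.toℕ<n v) ⟩
      n                                  ∎))
      where
      open ≤-Reasoning
      above-v : ∀ u → lookup R u ∧ not (down R u) ≡ true → (suc (toℕ v) ≤ᵇ toℕ u) ≡ true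
      above-v u eq with ∧-≡-true eq | FP.<-cmp u v
      ... | (u∈R , ¬downU) | tri< u<v _ _ = contradiction (trans (sym (up-closed u v u∈R (¬down⇒¬Down ¬downU) u<v)) v∈R?) λ ()
      ... | (u∈R , _) | tri≈ _ refl _ = contradiction (trans (sym u∈R) v∈R?) λ ()
      ... | _ | tri> _ _ v<u = ≤ᵇ-true v<u
      U≤ : U ≤ n ∸ suc (toℕ v)
      U≤ = ≤-trans (count-mono above-v) (≤-reflexive (count-from {n} (suc (toℕ v))))

    middle-Down⇒⊥ : ∀ {v} → lookup R v ≡ true → Down R v → ι R ≤ toℕ v → ⊥
    middle-Down⇒⊥ {v} v∈R downV ι≤v = <-irrefl refl (begin-strict
      ι R                                     ≤⟨ ι≤v ⟩
      toℕ v                                   <⟨ n<1+n _ ⟩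
      suc (toℕ v)                             ≡⟨ count-below {n} (suc (toℕ v)) (FP.toℕ<n v) ⟨
      count {n} (λ u → toℕ u <ᵇ suc (toℕ v))  ≤⟨ count-mono up-to-v ⟩
      ι R                                     ∎)
      where
      open ≤-Reasoning
      up-to-v : ∀ u → (toℕ u <ᵇ suc (toℕ v)) ≡ true → lookup R u ∧ down R u ≡ true
      up-to-v u u≤v with FP.<-cmp u v
      ... | tri< u<v _ _ rewrite down-closed v u v∈R downV u<v =
        dec-true (down? R u) (Down-downward R-plus (down-closed v u v∈R downV u<v) v∈R u<v downV)
      ... | tri≈ _ refl _ rewrite v∈R = dec-true (down? R u) downV
      ... | tri> _ _ v<u = ⊥-elim (<-irrefl refl (≤-trans (s≤s v<u) (<ᵇ-true⁻ u≤v)))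

    middle-¬Down⇒⊥ : ∀ {v} → lookup R v ≡ true → ¬ Down R v → toℕ v < n ∸ d + ι R → ⊥
    middle-¬Down⇒⊥ {v} v∈R ¬downV v<high = <-irrefl refl (begin-strict
      n                        ≡⟨ m+[n∸m]≡n (<⇒≤ (FP.toℕ<n v)) ⟨
      toℕ v + (n ∸ toℕ v)      ≡⟨ cong (toℕ v +_) (count-from {n} (toℕ v)) ⟨
      toℕ v + count {n} (λ u → toℕ v ≤ᵇ toℕ u)  ≤⟨ +-monoʳ-≤ (toℕ v) (count-mono from-v) ⟩
      toℕ v + U                <⟨ +-monoˡ-< U v<high ⟩
      n ∸ d + ι R + U          ≡⟨ +-assoc (n ∸ d) (ι R) U ⟩
      n ∸ d + (ι R + U)        ≡⟨ cong (n ∸ d +_) ι+U≡d ⟩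
      n ∸ d + d                ≡⟨ m∸n+n≡m d≤n ⟩
      n                        ∎)
      where
      open ≤-Reasoning
      from-v : ∀ u → (toℕ v ≤ᵇ toℕ u) ≡ true → lookup R u ∧ not (down R u) ≡ true
      from-v u v≤u with FP.<-cmp u v
      ... | tri< u<v _ _ = ⊥-elim (<⇒≱ u<v (≤ᵇ-true⁻ v≤u))
      ... | tri≈ _ refl _ rewrite v∈R | dec-false (down? R u) ¬downV = refl
      ... | tri> _ _ v<u rewrite up-closed v u v∈R ¬downV v<u
                               | dec-false (down? R u) (¬downV ∘ Down-downward R-plus v∈R (up-closed v u v∈R ¬downV v<u) v<u) = refl

    middle-outside : ∀ v → ι R ≤ toℕ v → toℕ v < n ∸ d + ι R → lookup R v ≡ false
    middle-outside v ι≤v v<high with lookup R v in v∈R?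
    ... | false = refl
    ... | true with down? R v
    ...   | yes downV = ⊥-elim (middle-Down⇒⊥ v∈R? downV ι≤v)
    ...   | no ¬downV = ⊥-elim (middle-¬Down⇒⊥ v∈R? ¬downV v<high)
    R≡Sndi : R ≡ Sndi n d (ι R)
    R≡Sndi = subset-ext pointwise
      where
      pointwise : ∀ v → lookup R v ≡ lookup (Sndi n d (ι R)) v
      pointwise v with toℕ v <? ι R
      ... | yes v<ι = trans (low-inside v v<ι) (sym (lookup-Sndi-low d v v<ι))
      ... | no v≮ι with n ∸ d + ι R ≤? toℕ v
      ...   | yes high = trans (high-inside v high) (sym (lookup-Sndi-high d v high))
      ...   | no ¬high =
        trans (middle-outside v (≮⇒≥ v≮ι) (≰⇒> ¬high)) (sym (lookup-Sndi-mid d v (≮⇒≥ v≮ι) (≰⇒> ¬high)))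

  DownStep UpStep : Subset n → Fin n → Fin n → Set
  DownStep R e y = lookup R e ≡ true × Down R e × y F.< e × lookup R y ≡ false
  UpStep   R e z = lookup R e ≡ true × ¬ Down R e × e F.< z × lookup R z ≡ false

  step-or-terminal : ∀ {R} → Plus d τ R → Move R ⊎ (DownClosed R × UpClosed R)
  step-or-terminal {R} R-plus with FP.any? {P = λ e → ∃ (DownStep R e)} (λ e → FP.any? (down-step? e))
                                | FP.any? {P = λ e → ∃ (UpStep R e)} (λ e → FP.any? (up-step? e))
    where
    down-step? : ∀ e y → Dec (DownStep R e y)
    down-step? e y = lookup R e Bool.≟ true ×-dec down? R e ×-dec y F.<? e ×-dec lookup R y Bool.≟ false
    up-step? : ∀ e z → Dec (UpStep R e z)
    up-step? e z = lookup R e Bool.≟ true ×-dec ¬? (down? R e) ×-dec e F.<? z ×-dec lookup R z Bool.≟ false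
  ... | yes (e , y , e∈R , downE , y<e , y∉R) | _ = inj₁ (move-down R-plus e∈R downE y<e y∉R)
  ... | no _ | yes (e , z , e∈R , ¬downE , e<z , z∉R) = inj₁ (move-up R-plus e∈R ¬downE e<z z∉R)
  ... | no ¬down-step | no ¬up-step =
    inj₂ ( (λ e y e∈R downE y<e → ¬-not λ y∉R → ¬down-step (e , y , e∈R , downE , y<e , y∉R))
         , (λ e z e∈R ¬downE e<z → ¬-not λ z∉R → ¬up-step (e , z , e∈R , ¬downE , e<z , z∉R)) )

  Plus⇒Reach : ∀ {R} → Plus d τ R → Reach d τ (Sndi n d (ι R)) R
  Plus⇒Reach {R} = walk R (ℕInd.<-wellFounded (Φ R))
    where
    walk : ∀ R → Acc _<_ (Φ R) → Plus d τ R → Reach d τ (Sndi n d (ι R)) R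
    walk R (acc smaller) R-plus with step-or-terminal R-plus
    ... | inj₁ move = step (subst (λ i → Reach d τ (Sndi n d i) next) ι-next≡ι-R (walk next (smaller Φ-decreases) next-plus))
                        next~R R-plus
      where
      open Move move
      ι-next≡ι-R : ι next ≡ ι R
      ι-next≡ι-R = ι-Siblings (Adjacent⇒Siblings next~R) next-plus R-plus
    ... | inj₂ (down-closed , up-closed) =
      subst (Reach d τ (Sndi n d (ι R))) (sym R≡Sndi) (here (subst (Plus d τ) R≡Sndi R-plus))
      where open Terminal R-plus down-closed up-closed

-- The p-sequence

module PSequence {n d p : ℕ} (d<n : d < n) (p≤n∸d : p ≤ n ∸ d) {τ : SignFn n} (τ-cos : IsCoSignotope n d τ)
  (plus-size : HasSize (Plus d τ) p) where

  open SmallCoSignotope τ τ-cos plus-size p≤n∸d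

  plus-list : List (Subset n)
  plus-list = proj₁ plus-size

  ∈plus-list⇔ : ∀ R → R ∈ plus-list ⇔ Plus d τ R
  ∈plus-list⇔ = proj₂ (proj₂ (proj₂ plus-size))

  component : Fin (suc d) → List (Subset n)
  component i = filter (λ R → ι R ≟ toℕ i) plus-list

  ι-Comp : ∀ i {R} → Comp n d τ i R → ι R ≡ toℕ i
  ι-Comp i R∈Cᵢ = trans (ι-Reach R∈Cᵢ) (ι-Sndi (s≤s⁻¹ (FP.toℕ<n i)) d<n (Reach-source-plus R∈Cᵢ))

  ∈component⇔ : ∀ i R → R ∈ component i ⇔ Comp n d τ i R
  ∈component⇔ i R = mk⇔ to from
    where
    to : R ∈ component i → Comp n d τ i R
    to R∈ with ∈-filter⁻ (λ R → ι R ≟ toℕ i) {xs = plus-list} R∈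
    ... | R∈plus , ιR≡i =
      subst (λ j → Reach d τ (Sndi n d j) R) ιR≡i (Plus⇒Reach (Equivalence.to (∈plus-list⇔ R) R∈plus))
    from : Comp n d τ i R → R ∈ component i
    from R∈Cᵢ =
      ∈-filter⁺ (λ R → ι R ≟ toℕ i) (Equivalence.from (∈plus-list⇔ R) (Reach-plus R∈Cᵢ)) (ι-Comp i R∈Cᵢ)

  p-sequence : Vec ℕ (suc d)
  p-sequence = tabulate (length ∘ component)

  lookup-p-sequence : ∀ i → lookup p-sequence i ≡ length (component i)
  lookup-p-sequence = VP.lookup∘tabulate (length ∘ component)

  p-sequence-IsPSeq : IsPSeq n d τ p-sequence
  p-sequence-IsPSeq i = component i , UP.filter⁺ _ (proj₁ (proj₂ plus-size)) , sym (lookup-p-sequence i) , ∈component⇔ i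

  sum-p-sequence : V.sum p-sequence ≡ p
  sum-p-sequence = begin
    V.sum p-sequence                  ≡⟨ sum-tabulate (length ∘ component) ⟩
    ∑ (length ∘ component)
      ≡⟨ ∑-length-filter ι plus-list (λ {R} R∈ → s≤s (ι≤d (Equivalence.to (∈plus-list⇔ R) R∈))) ⟩
    length plus-list                  ≡⟨ proj₁ (proj₂ (proj₂ plus-size)) ⟩
    p                                 ∎
    where open ≡-Reasoning

  component-nonempty⇒Sndi-plus : ∀ i {R Rs} → component i ≡ R ∷ Rs → Plus d τ (Sndi n d (toℕ i))
  component-nonempty⇒Sndi-plus i {R} eq = Reach-source-plus (Equivalence.to (∈component⇔ i R) (subst (R ∈_) (sym eq) (here refl)))

  p-sequence-sparse : (i : Fin d) → lookup p-sequence (fsuc i) ≡ 0 ⊎ lookup p-sequence (inject₁ i) ≡ 0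
  p-sequence-sparse i with component (fsuc i) in cᵢ₊₁ | component (inject₁ i) in cᵢ
  ... | []    | _     = inj₁ (trans (lookup-p-sequence (fsuc i)) (cong length cᵢ₊₁))
  ... | _ ∷ _ | []    = inj₂ (trans (lookup-p-sequence (inject₁ i)) (cong length cᵢ))
  ... | _ ∷ _ | _ ∷ _ = ⊥-elim (not-both-Sndi (FP.toℕ<n i) d<n
    (subst (λ j → Plus d τ (Sndi n d j)) (FP.toℕ-inject₁ i) (component-nonempty⇒Sndi-plus (inject₁ i) cᵢ))
    (component-nonempty⇒Sndi-plus (fsuc i) cᵢ₊₁))

p-sequence-sparse-composition : ∀ {n d p} → d < n → p ≤ n ∸ d → (τ : SignFn n) → InSbar n d p τ →
  Σ (Vec ℕ (suc d)) λ c → IsPSeq n d τ c × IsSparseComposition p d c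
p-sequence-sparse-composition d<n p≤n∸d τ (τ-cos , τ-size) =
  p-sequence , p-sequence-IsPSeq , sum-p-sequence , p-sequence-sparse
  where open PSequence d<n p≤n∸d τ-cos τ-size

-- Gluing co-signotopes

module TwoSmallCoSignotopes {n d a₁ a₂ : ℕ} {τ₁ τ₂ : SignFn n}
  (τ₁-cos : IsCoSignotope n d τ₁) (τ₂-cos : IsCoSignotope n d τ₂)
  (size₁ : HasSize (Plus d τ₁) a₁) (size₂ : HasSize (Plus d τ₂) a₂) (a₁+a₂≤n∸d : a₁ + a₂ ≤ n ∸ d) where

  module T₁ = SmallCoSignotope τ₁ τ₁-cos size₁ (≤-trans (m≤m+n a₁ a₂) a₁+a₂≤n∸d)
  module T₂ = SmallCoSignotope τ₂ τ₂-cos size₂ (≤-trans (m≤n+m a₂ a₁) a₁+a₂≤n∸d)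

  -- The upper part of the (R,e)-series consists of +-subsets of τ₁, the lower part of the
  -- (S,e)-series of +-subsets of τ₂; together they have more than n - d entries.
  no-Up₁-Down₂ : ∀ C {x x′ e} → lookup C x ≡ false → lookup C x′ ≡ false → lookup C e ≡ true →
    Plus d τ₁ (add C x) → Plus d τ₂ (add C x′) → ¬ T₁.Down (add C x) e → T₂.Down (add C x′) e → ⊥
  no-Up₁-Down₂ C {x} {x′} {e} x∉C x′∉C e∈C R-plus S-plus ¬down₁ down₂ = <-irrefl refl (begin-strict
    n ∸ d                                   <⟨ n<1+n _ ⟩
    suc (n ∸ d)                             ≤⟨ halves-count (proj₁ R-plus) ⟩
    count upper-half + count lower-half     ≤⟨ +-mono-≤ upper≤a₁ lower≤a₂ ⟩
    a₁ + a₂                                 ≤⟨ a₁+a₂≤n∸d ⟩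
    n ∸ d                                   ∎)
    where
    open ≤-Reasoning
    open SiblingSeries C x x′ e x∉C x′∉C e∈C
    upper≤a₁ : count upper-half ≤ a₁
    upper≤a₁ = T₁.plus-family≤a _ (exchange R e) plus
      (λ z z′ z∈ _ → exchange-injective R e (not≡true (proj₂ (∧-≡-true z∈))))
      where
      plus : ∀ z → upper-half z ≡ true → Plus d τ₁ (exchange R e z)
      plus z z∈ with ∧-≡-true z∈
      ... | e≤z , z∉ with z FP.≟ e
      ...   | yes refl = T₁.exchange-self-plus R-plus e∈R
      ...   | no z≢e   = T₁.exchange-plus R-plus e∈R (not≡true z∉)
                           (T₁.¬Down⇒Up R-plus e∈R ¬down₁ z (FP.≤∧≢⇒< (≤ᵇ-true⁻ e≤z) (z≢e ∘ sym))
                             (lookup-minus-outside⁻ R e z z≢e (not≡true z∉)))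
    lower≤a₂ : count lower-half ≤ a₂
    lower≤a₂ = T₂.plus-family≤a _ (exchange S e) plus
      (λ z z′ z∈ _ → exchange-injective S e (not≡true (proj₂ (∧-≡-true z∈))))
      where
      plus : ∀ z → lower-half z ≡ true → Plus d τ₂ (exchange S e z)
      plus z z∈ with ∧-≡-true z∈
      ... | z≤e , z∉ with z FP.≟ e
      ...   | yes refl = T₂.exchange-self-plus S-plus e∈S
      ...   | no z≢e   = T₂.exchange-plus S-plus e∈S (not≡true z∉) (down₂ z (FP.≤∧≢⇒< (≤ᵇ-true⁻ z≤e) z≢e)
                           (lookup-minus-outside⁻ S e z z≢e (not≡true z∉)))
  -- A common element that is Down for τ₂ is Down for τ₁ by no-Up₁-Down₂; only x′ can add one more.
  ι-siblings-gap : ∀ C {x x′} → lookup C x ≡ false → lookup C x′ ≡ false →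
    Plus d τ₁ (add C x) → Plus d τ₂ (add C x′) → T₂.ι (add C x′) ≤ suc (T₁.ι (add C x))
  ι-siblings-gap C {x} {x′} x∉C x′∉C R-plus S-plus = ≮⇒≥ λ gap →
    let (e , e∈C∧down₂ , e∉C∨¬down₁) = count-<-witness down₁-on-C down₂-on-C (+-cancelʳ-≤ 1 _ _ (begin
          suc (count down₁-on-C) + 1      ≡⟨ +-comm (suc (count down₁-on-C)) 1 ⟩
          suc (suc (count down₁-on-C))    ≤⟨ s≤s (s≤s (count-mono (λ w eq → within-R w eq))) ⟩
          suc (suc (T₁.ι (add C x)))      ≤⟨ gap ⟩
          T₂.ι (add C x′)                 ≡⟨ T₂.ι-add C x′ x′∉C ⟩
          count down₂-on-C + bit (T₂.down (add C x′) x′) ≤⟨ +-monoʳ-≤ (count down₂-on-C) (bit≤1 _) ⟩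
          count down₂-on-C + 1            ∎))
        (e∈C , down₂) = ∧-≡-true e∈C∧down₂
    in no-Up₁-Down₂ C x∉C x′∉C e∈C R-plus S-plus
         (T₁.¬down⇒¬Down (cong not (subst (λ b → b ∧ T₁.down (add C x) e ≡ false) e∈C e∉C∨¬down₁)))
         (T₂.down⇒Down down₂)
    where
    open ≤-Reasoning
    down₁-on-C down₂-on-C : Fin n → Bool
    down₁-on-C w = lookup C w ∧ T₁.down (add C x) w
    down₂-on-C w = lookup C w ∧ T₂.down (add C x′) w
    within-R : ∀ w → down₁-on-C w ≡ true → lookup (add C x) w ∧ T₁.down (add C x) w ≡ true
    within-R w eq with ∧-≡-true eq
    ... | w∈C , down rewrite lookup-add-inside C x w w∈C | down = refl

module Gluing {n d p : ℕ} (d<n : d < n) (p≤n∸d : p ≤ n ∸ d) {c : Vec ℕ (suc d)} (c-sparse : IsSparseComposition p d c)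
  {τs : Fin (suc d) → SignFn n} (τs-single : (i : Fin (suc d)) → InSbarComp n d (lookup c i) i (τs i)) where

  τs-cos : ∀ i → IsCoSignotope n d (τs i)
  τs-cos i = proj₁ (proj₁ (τs-single i))

  τs-size : ∀ i → HasSize (Plus d (τs i)) (lookup c i)
  τs-size i = proj₂ (proj₁ (τs-single i))

  plus⇒Comp : ∀ i {R} → Plus d (τs i) R → Comp n d (τs i) i R
  plus⇒Comp i = proj₂ (τs-single i) _

  ∑c≡p : ∑ (lookup c) ≡ p
  ∑c≡p = trans (sym (sum-tabulate (lookup c))) (trans (cong V.sum (VP.tabulate∘lookup c)) (proj₁ c-sparse))

  cᵢ≤n∸d : ∀ i → lookup c i ≤ n ∸ d
  cᵢ≤n∸d i = ≤-trans (term≤∑ (lookup c) i) (subst (_≤ n ∸ d) (sym ∑c≡p) p≤n∸d)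

  module T (i : Fin (suc d)) = SmallCoSignotope (τs i) (τs-cos i) (τs-size i) (cᵢ≤n∸d i)

  module Two (i j : Fin (suc d)) (i≢j : i ≢ j) = TwoSmallCoSignotopes (τs-cos i) (τs-cos j) (τs-size i) (τs-size j)
    (≤-trans (two-terms≤∑ (lookup c) i j i≢j) (subst (_≤ n ∸ d) (sym ∑c≡p) p≤n∸d))

  ι-τs : ∀ i {R} → Plus d (τs i) R → T.ι i R ≡ toℕ i
  ι-τs i R-plus with plus⇒Comp i R-plus
  ... | R∈Cᵢ = trans (T.ι-Reach i R∈Cᵢ) (T.ι-Sndi i (s≤s⁻¹ (FP.toℕ<n i)) d<n (T.Reach-source-plus i R∈Cᵢ))

  cᵢ>0 : ∀ i {R} → Plus d (τs i) R → 0 < lookup c i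
  cᵢ>0 i {R} R-plus with τs-size i
  ... | L , _ , length≡cᵢ , ∈L⇔ = subst (0 <_) length≡cᵢ (nonempty (Equivalence.from (∈L⇔ R) R-plus))
    where
    nonempty : ∀ {L : List (Subset n)} → R ∈ L → 0 < length L
    nonempty {_ ∷ _} _ = s≤s z≤n

  -- Indices two apart are excluded by the ι-gap, adjacent indices by sparseness.
  siblings-index-< : ∀ {i j R S} → Siblings R S → Plus d (τs i) R → Plus d (τs j) S → toℕ i < toℕ j → ⊥
  siblings-index-< {i} {j} (siblings C x x′ x∉C x′∉C) R-plus S-plus i<j with toℕ j ≟ suc (toℕ i)
  ... | no j≢1+i = <⇒≱ (≤∧≢⇒< i<j (j≢1+i ∘ sym)) (begin
    toℕ j                   ≡⟨ ι-τs j S-plus ⟨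
    T.ι j (add C x′)        ≤⟨ Two.ι-siblings-gap i j (FP.<⇒≢ i<j) C x∉C x′∉C R-plus S-plus ⟩
    suc (T.ι i (add C x))   ≡⟨ cong suc (ι-τs i R-plus) ⟩
    suc (toℕ i)             ∎)
    where open ≤-Reasoning
  ... | yes j≡1+i with consecutive-indices j≡1+i
  ...   | k , refl , refl with proj₂ c-sparse k
  ...     | inj₁ cₖ₊₁≡0 = <-irrefl (sym cₖ₊₁≡0) (cᵢ>0 (fsuc k) S-plus)
  ...     | inj₂ cₖ≡0   = <-irrefl (sym cₖ≡0) (cᵢ>0 (inject₁ k) R-plus)

  siblings-same-index : ∀ {i j R S} → Siblings R S → Plus d (τs i) R → Plus d (τs j) S → i ≡ j
  siblings-same-index {i} {j} R~S R-plus S-plus with FP.<-cmp i j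
  ... | tri< i<j _ _ = ⊥-elim (siblings-index-< R~S R-plus S-plus i<j)
  ... | tri≈ _ i≡j _ = i≡j
  ... | tri> _ _ j<i = ⊥-elim (siblings-index-< (Siblings-sym R~S) S-plus R-plus j<i)

  same-set-same-index : ∀ {i j R} → Plus d (τs i) R → Plus d (τs j) R → i ≡ j
  same-set-same-index {i} {j} {R} Rᵢ Rⱼ with DSP.nonempty? R
  ... | yes (e , e∈R) = siblings-same-index (Siblings-refl R e (VP.[]=⇒lookup e∈R)) Rᵢ Rⱼ
  ... | no R-empty = FP.toℕ-injective (trans (index≡0 i) (sym (index≡0 j)))
    where
    d≡0 : d ≡ 0
    d≡0 = trans (sym (proj₁ Rᵢ)) (trans (cong ∣_∣ (DSP.Empty-unique R-empty)) (DSP.∣⊥∣≡0 n))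
    index≡0 : ∀ (k : Fin (suc d)) → toℕ k ≡ 0
    index≡0 k = n≤0⇒n≡0 (subst (toℕ k ≤_) d≡0 (s≤s⁻¹ (FP.toℕ<n k)))

  τ : SignFn n
  τ R with FP.any? (λ i → τs i R ≟ˢ ⊕)
  ... | yes _ = ⊕
  ... | no _  = ⊖

  τ-⊕⇒ : ∀ {R} → τ R ≡ ⊕ → ∃ λ i → τs i R ≡ ⊕
  τ-⊕⇒ {R} τR with FP.any? (λ i → τs i R ≟ˢ ⊕)
  ... | yes found = found
  ... | no _      = contradiction τR λ ()

  ⇒τ-⊕ : ∀ {i R} → τs i R ≡ ⊕ → τ R ≡ ⊕
  ⇒τ-⊕ {i} {R} τᵢR with FP.any? (λ i → τs i R ≟ˢ ⊕)
  ... | yes _    = refl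
  ... | no none  = ⊥-elim (none (i , τᵢR))

  τ-⊖⇒ : ∀ {R} → τ R ≡ ⊖ → ∀ i → τs i R ≡ ⊖
  τ-⊖⇒ {R} τR i with τs i R in τᵢR
  ... | ⊖ = refl
  ... | ⊕ = contradiction (trans (sym (⇒τ-⊕ τᵢR)) τR) λ ()

  Plus-τs⇒Plus-τ : ∀ {i R} → Plus d (τs i) R → Plus d τ R
  Plus-τs⇒Plus-τ (∣R∣≡d , τᵢR) = ∣R∣≡d , ⇒τ-⊕ τᵢR

  Plus-τ⇒Plus-τs : ∀ {R} → Plus d τ R → ∃ λ i → Plus d (τs i) R
  Plus-τ⇒Plus-τs (∣R∣≡d , τR) with τ-⊕⇒ τR
  ... | i , τᵢR = i , ∣R∣≡d , τᵢR

  τ-on-series : ∀ B b k → (∀ {R} → R ∈ series B b → τ R ≡ ⊕ → τs k R ≡ ⊕) →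
    map τ (series B b) ≡ map (τs k) (series B b)
  τ-on-series B b k plus-in-k = LP.map-cong-local (All.tabulate agree)
    where
    agree : ∀ {R} → R ∈ series B b → τ R ≡ τs k R
    agree {R} R∈ with τ R in τR
    ... | ⊕ = sym (plus-in-k R∈ τR)
    ... | ⊖ = sym (τ-⊖⇒ τR k)

  -- All +-entries of a series belong to the same τᵢ, so on the series τ coincides with that τᵢ.
  τ-cos : IsCoSignotope n d τ
  τ-cos B b ∣B∣≡d b∈B with Any.any? (λ R → τ R ≟ˢ ⊕) (series B b)
  ... | no no-plus = subst (λ σ → changes σ ≤ 1) (sym (τ-on-series B b fzero λ R∈ τR → ⊥-elim (no-plus (lose R∈ τR))))
                       (τs-cos fzero B b ∣B∣≡d b∈B)
  ... | yes has-plus with find has-plus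
  ...   | R , R∈ , τR with τ-⊕⇒ τR
  ...     | k , τₖR = subst (λ σ → changes σ ≤ 1) (sym (τ-on-series B b k plus-in-k)) (τs-cos k B b ∣B∣≡d b∈B)
    where
    plus-in-k : ∀ {R′} → R′ ∈ series B b → τ R′ ≡ ⊕ → τs k R′ ≡ ⊕
    plus-in-k {R′} R′∈ τR′ with τ-⊕⇒ τR′
    ... | j , τⱼR′ = subst (λ i → τs i R′ ≡ ⊕) (siblings-same-index (∈-series⇒Siblings B b R′∈ R∈)
                       (∈-series⇒IsDSubset B b ∣B∣≡d (VP.[]=⇒lookup b∈B) R′∈ , τⱼR′)
                       (∈-series⇒IsDSubset B b ∣B∣≡d (VP.[]=⇒lookup b∈B) R∈ , τₖR)) τⱼR′

  plus-list : Fin (suc d) → List (Subset n)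
  plus-list i = proj₁ (τs-size i)

  ∈plus-list⇔ : ∀ i R → R ∈ plus-list i ⇔ Plus d (τs i) R
  ∈plus-list⇔ i = proj₂ (proj₂ (proj₂ (τs-size i)))

  τ-size : HasSize (Plus d τ) p
  τ-size = List.concat (List.tabulate plus-list) , unique , length≡p , λ R → mk⇔ to from
    where
    unique : Unique (List.concat (List.tabulate plus-list))
    unique = UP.concat⁺ (AllP.tabulate⁺ (λ i → proj₁ (proj₂ (τs-size i))))
      (AllPairsP.tabulate⁺ λ i≢j (R∈ᵢ , R∈ⱼ) →
        i≢j (same-set-same-index (Equivalence.to (∈plus-list⇔ _ _) R∈ᵢ) (Equivalence.to (∈plus-list⇔ _ _) R∈ⱼ)))
    length≡p : length (List.concat (List.tabulate plus-list)) ≡ p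
    length≡p = trans (length-concat-tabulate plus-list) (trans (∑-cong (λ i → proj₁ (proj₂ (proj₂ (τs-size i))))) ∑c≡p)
    to : ∀ {R} → R ∈ List.concat (List.tabulate plus-list) → Plus d τ R
    to {R} R∈ with AnyP.tabulate⁻ (∈-concat⁻ (List.tabulate plus-list) R∈)
    ... | i , R∈ᵢ = Plus-τs⇒Plus-τ (Equivalence.to (∈plus-list⇔ i R) R∈ᵢ)
    from : ∀ {R} → Plus d τ R → R ∈ List.concat (List.tabulate plus-list)
    from {R} R-plus with Plus-τ⇒Plus-τs R-plus
    ... | i , Rᵢ = ∈-concat⁺ (AnyP.tabulate⁺ {f = plus-list} i (Equivalence.from (∈plus-list⇔ i R) Rᵢ))

  Reach-τs⇒Reach-τ : ∀ {i S R} → Reach d (τs i) S R → Reach d τ S R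
  Reach-τs⇒Reach-τ (here S-plus)          = here (Plus-τs⇒Plus-τ S-plus)
  Reach-τs⇒Reach-τ (step r R~R′ R′-plus)  = step (Reach-τs⇒Reach-τ r) R~R′ (Plus-τs⇒Plus-τ R′-plus)

  Comp-τ⇒Plus-τs : ∀ i {R} → Comp n d τ i R → Plus d (τs i) R
  Comp-τ⇒Plus-τs i (here Sᵢ-plus) with Plus-τ⇒Plus-τs Sᵢ-plus
  ... | k , Sᵢ-plusₖ = subst (λ j → Plus d (τs j) (Sndi n d (toℕ i))) k≡i Sᵢ-plusₖ
    where
    k≡i : k ≡ i
    k≡i = FP.toℕ-injective (trans (sym (ι-τs k Sᵢ-plusₖ)) (T.ι-Sndi k (s≤s⁻¹ (FP.toℕ<n i)) d<n Sᵢ-plusₖ))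
  Comp-τ⇒Plus-τs i (step r R~R′ R′-plus) with Plus-τ⇒Plus-τs R′-plus
  ... | k , R′-plusₖ = subst (λ j → Plus d (τs j) _)
        (sym (siblings-same-index (Adjacent⇒Siblings R~R′) (Comp-τ⇒Plus-τs i r) R′-plusₖ)) R′-plusₖ

  τ-IsPSeq : IsPSeq n d τ c
  τ-IsPSeq i = plus-list i , proj₁ (proj₂ (τs-size i)) , proj₁ (proj₂ (proj₂ (τs-size i))) , λ R → mk⇔
    (λ R∈ → Reach-τs⇒Reach-τ (plus⇒Comp i (Equivalence.to (∈plus-list⇔ i R) R∈)))
    (λ R∈Cᵢ → Equivalence.from (∈plus-list⇔ i R) (Comp-τ⇒Plus-τs i R∈Cᵢ))

  τ-IsDecomposition : IsDecomposition n d τ τs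
  τ-IsDecomposition i R ∣R∣≡d =
    mk⇔ (λ τᵢR → Reach-τs⇒Reach-τ (plus⇒Comp i (∣R∣≡d , τᵢR))) (proj₂ ∘ Comp-τ⇒Plus-τs i)

  -- A +-subset of τ′ lies in the component C_{ι R} of τ′, i.e. is + for τ_{ι R}; and conversely.
  τ-unique : (τ′ : SignFn n) → InSbar n d p τ′ × IsPSeq n d τ′ c × IsDecomposition n d τ′ τs →
    (R : Subset n) → IsDSubset d R → τ′ R ≡ τ R
  τ-unique τ′ ((τ′-cos , τ′-size) , _ , τ′-decomposition) R ∣R∣≡d with τ′ R in τ′R
  ... | ⊕ = sym (⇒τ-⊕ (Equivalence.from (τ′-decomposition k R ∣R∣≡d) R∈Cₖ))
    where
    open SmallCoSignotope τ′ τ′-cos τ′-size p≤n∸d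
    k : Fin (suc d)
    k = fromℕ< (s≤s (ι≤d (∣R∣≡d , τ′R)))
    R∈Cₖ : Comp n d τ′ k R
    R∈Cₖ = subst (λ j → Reach d τ′ (Sndi n d j) R) (sym (FP.toℕ-fromℕ< (s≤s (ι≤d (∣R∣≡d , τ′R)))))
             (Plus⇒Reach (∣R∣≡d , τ′R))
  ... | ⊖ with τ R in τR
  ...   | ⊖ = refl
  ...   | ⊕ with τ-⊕⇒ τR
  ...     | k , τₖR = contradiction (trans (sym (proj₂ (SmallCoSignotope.Reach-plus τ′ τ′-cos τ′-size p≤n∸d
                        (Equivalence.to (τ′-decomposition k R ∣R∣≡d) τₖR)))) τ′R) λ ()

glued-co-signotope : ∀ {n d p} → d < n → p ≤ n ∸ d → (c : Vec ℕ (suc d)) → IsSparseComposition p d c →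
  (τs : Fin (suc d) → SignFn n) → ((i : Fin (suc d)) → InSbarComp n d (lookup c i) i (τs i)) →
  Σ (SignFn n) λ τ →
    (InSbar n d p τ × IsPSeq n d τ c × IsDecomposition n d τ τs)
    × ((τ′ : SignFn n) → InSbar n d p τ′ × IsPSeq n d τ′ c × IsDecomposition n d τ′ τs →
       (R : Subset n) → IsDSubset d R → τ′ R ≡ τ R)
glued-co-signotope d<n p≤n∸d c c-sparse τs τs-single =
  τ , ((τ-cos , τ-size) , τ-IsPSeq , τ-IsDecomposition) , τ-unique
  where open Gluing d<n p≤n∸d {c} c-sparse {τs} τs-single

lemma18 : (n d p : ℕ) → d < n → p ≤ n ∸ d →
    ((τ : SignFn n) → InSbar n d p τ →
      Σ (Vec ℕ (suc d)) λ c → IsPSeq n d τ c × IsSparseComposition p d c)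
    ×
    ((c : Vec ℕ (suc d)) → IsSparseComposition p d c →
     (τs : Fin (suc d) → SignFn n) →
     ((i : Fin (suc d)) → InSbarComp n d (lookup c i) i (τs i)) →
      Σ (SignFn n) λ τ →
        (InSbar n d p τ × IsPSeq n d τ c × IsDecomposition n d τ τs)
        × ((τ′ : SignFn n) →
           InSbar n d p τ′ × IsPSeq n d τ′ c × IsDecomposition n d τ′ τs →
           (R : Subset n) → IsDSubset d R → τ′ R ≡ τ R))
lemma18 n d p d<n p≤n∸d = p-sequence-sparse-composition d<n p≤n∸d , glued-co-signotope d<n p≤n∸d
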